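{- For every skew shape $\lambda/\mu$ there exists an involution $\Phi$ on $\mathrm{SVRPP}^{12}(\lambda/\mu)$ such that for all $T$: $\mathrm{ceq}(\Phi(T))=\mathrm{ceq}(T)$, $\mathrm{ex}(\Phi(T))=\mathrm{ex}(T)$, and $\mathrm{ircont}(\Phi(T))$ is obtained from $\mathrm{ircont}(T)$ by exchanging its first two entries.
   Context: Boxes are $(i,j)$ (row $i$, column $j$); $\lambda/\mu$ is the skew diagram. An SVRPP of shape $\lambda/\mu$ is a filling $T$ by nonempty finite sets $T(i,j)$ of positive integers, weakly increasing along rows and down columns, where $A\le B$ means $\max A\le\min B$. $\mathrm{SVRPP}^{12}(\lambda/\mu)$ is the set of SVRPPs all of whose sets are subsets of $\{1,2\}$. $\mathrm{ircont}(T)=(r_1,r_2,\ldots)$, $r_k$ = number of columns containing a box whose set contains $k$; $\mathrm{ceq}(T)=(c_i)$, $c_i$ = number of boxes $(i,j)$ with $(i+1,j)\in\lambda/\mu$ and $\max T(i,j)=\min T(i+1,j)$; $\mathrm{ex}(T)=(e_i)$, $e_i=\sum_{(i,j)\in\lambda/\mu}(|T(i,j)|-1)$. -}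

module Defs where

open import Data.Nat using (ℕ; zero; suc; _+_; _∸_; _≤_; _≥_; _<ᵇ_; _≡ᵇ_)
open import Data.Bool using (Bool; true; false; if_then_else_; _∨_)
open import Data.List using (List; []; _∷_; length; map)
open import Data.Nat.ListAction using (sum)
open import Data.List.Relation.Unary.Linked using (Linked)
open import Data.Maybe using (Maybe; just; nothing)
open import Data.Product using (_×_)
open import Relation.Binary.PropositionalEquality using (_≡_)

-- Nonempty subsets of {1,2}: {1}, {2}, {1,2}.
data S12 : Set where
  s1 s2 s12 : S12

minS : S12 → ℕ
minS s1  = 1
minS s2  = 2
minS s12 = 1

maxS : S12 → ℕ
maxS s1  = 1
maxS s2  = 2
maxS s12 = 2

card : S12 → ℕ
card s1  = 1
card s2  = 1
card s12 = 2

hasElem : S12 → ℕ → Bool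
hasElem s1  k = k ≡ᵇ 1
hasElem s2  k = k ≡ᵇ 2
hasElem s12 k = (k ≡ᵇ 1) ∨ (k ≡ᵇ 2)

nth : {A : Set} → List A → ℕ → Maybe A
nth []       _       = nothing
nth (x ∷ xs) zero    = just x
nth (x ∷ xs) (suc i) = nth xs i

part : List ℕ → ℕ → ℕ
part []       _       = 0
part (x ∷ xs) zero    = x
part (x ∷ xs) (suc i) = part xs i

IsPartition : List ℕ → Set
IsPartition la = Linked _≥_ la × (∀ i → i Data.Nat.< length la → 1 ≤ part la i)

Contained : List ℕ → List ℕ → Set
Contained mu la = ∀ i → part mu i ≤ part la i

-- A filling of la/mu is a list of rows; row i (0-indexed) lists the entries of
-- boxes (i, mu_i), (i, mu_i + 1), ..., (i, la_i - 1) (columns 0-indexed).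
Filling : Set
Filling = List (List S12)

entry : List ℕ → Filling → ℕ → ℕ → Maybe S12
entry mu T i j with nth T i
... | nothing  = nothing
... | just row = if j <ᵇ part mu i then nothing else nth row (j ∸ part mu i)

rowAt : Filling → ℕ → List S12
rowAt T i with nth T i
... | nothing  = []
... | just row = row

_≤S_ : S12 → S12 → Set
A ≤S B = maxS A ≤ minS B

IsSVRPP12 : List ℕ → List ℕ → Filling → Set
IsSVRPP12 la mu T =
  (length T ≡ length la)
  × (∀ i → i Data.Nat.< length la → length (rowAt T i) ≡ part la i ∸ part mu i)
  × (∀ i j a b → entry mu T i j ≡ just a → entry mu T i (suc j) ≡ just b → a ≤S b)
  × (∀ i j a b → entry mu T i j ≡ just a → entry mu T (suc i) j ≡ just b → a ≤S b)

count : (ℕ → Bool) → ℕ → ℕ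
count f zero    = 0
count f (suc n) = count f n + (if f n then 1 else 0)

anyBelow : (ℕ → Bool) → ℕ → Bool
anyBelow f zero    = false
anyBelow f (suc n) = anyBelow f n ∨ f n

-- number of columns of the shape (all columns lie below la_0)
width : List ℕ → ℕ
width la = part la 0

entryHas : Maybe S12 → ℕ → Bool
entryHas nothing  k = false
entryHas (just A) k = hasElem A k

ircont : List ℕ → List ℕ → Filling → ℕ → ℕ
ircont la mu T k =
  count (λ j → anyBelow (λ i → entryHas (entry mu T i j) k) (length la)) (width la)

ceqTest : Maybe S12 → Maybe S12 → Bool
ceqTest (just a) (just b) = maxS a ≡ᵇ minS b
ceqTest _        _        = false

ceq : List ℕ → List ℕ → Filling → ℕ → ℕ
ceq la mu T i = count (λ j → ceqTest (entry mu T i j) (entry mu T (suc i) j)) (width la)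

ex : Filling → ℕ → ℕ
ex T i = sum (map (λ A → card A ∸ 1) (rowAt T i))

swap12 : ℕ → ℕ
swap12 1 = 2
swap12 2 = 1
swap12 k = k

-- A row with entries in {1,2} reads 1…1, at most one {1,2}, 2…2, so a filling is determined by
-- the column q i where the 2s of row i start and by whether row i contains {1,2}.  Keeping the
-- latter fixes ex; keeping, for adjacent rows, the number of columns with T(i,j) = {1} above
-- T(i+1,j) = {2} fixes ceq.  After shifting q i by partial sums s i of these fixed data, column
-- strictness together with the prescribed counts becomes the chain condition
-- A (i+1) ⊔ x (i+1) = x i ⊓ G i for x i = q i + s i, and the numbers of columns without a 1,
-- resp. without a 2, become Σ (A i ∸ x i) and Σ (x i ∸ G i).
--
-- Replacing A and G by their monotone hulls F ≤ H, such a chain is a descending path pinned at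
-- the cuts b where F b = H b.  Between consecutive cuts it is x k = clamp (F (k+1)) σ (H k) for a
-- single level σ in [B, T] (the bounds at the two cuts), where σ ∸ B is the total excess
-- Σ (x k ∸ H (k+1)) and T ∸ σ the total deficit Σ (F k ∸ x k) of the block.  Mirroring σ to
-- B + T ∸ σ on every block is therefore an involution that exchanges the two sums.

module Submission where

open import Defs
open import Data.Nat
open import Data.Nat.Properties
open import Data.Bool using (Bool; true; false; if_then_else_; T; not; _∧_; _∨_)
open import Data.Bool.Properties using (T-≡; ∧-zeroʳ; ∧-identityʳ; ∨-zeroʳ)
open import Data.Unit using (tt)
open import Data.List using (List; []; _∷_; length; map; replicate; _++_; applyUpTo)
open import Data.List.Properties using (length-replicate; length-applyUpTo)
open import Data.List.Relation.Unary.Linked using (Linked; _∷_)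
open import Data.Nat.ListAction using (sum)
open import Data.Maybe using (Maybe; just; nothing)
open import Data.Product using (Σ; _×_; _,_; proj₁; proj₂)
open import Data.Sum using (inj₁; inj₂)
open import Function.Base using (_∘_)
open import Function.Bundles using (Equivalence)
open import Relation.Binary.PropositionalEquality
open import Relation.Nullary using (yes; no; ¬_; contradiction)
open import Algebra.Properties.CommutativeSemigroup +-commutativeSemigroup using (interchange)
open import Data.Nat.Solver using (module +-*-Solver)
open +-*-Solver

m⊔n≡n+[m∸n] : ∀ m n → m ⊔ n ≡ n + (m ∸ n)
m⊔n≡n+[m∸n] m n with ≤-total m n
... | inj₁ m≤n rewrite m≤n⇒m⊔n≡n m≤n | m≤n⇒m∸n≡0 m≤n = sym (+-identityʳ n)
... | inj₂ n≤m rewrite m≥n⇒m⊔n≡m n≤m = sym (m+[n∸m]≡n n≤m)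

m≡m⊓n+[m∸n] : ∀ m n → m ≡ (m ⊓ n) + (m ∸ n)
m≡m⊓n+[m∸n] m n = sym (trans (cong (_+ (m ∸ n)) (⊓-comm m n)) (m⊓n+n∸m≡n n m))

m∸n≡[m⊔n]∸n : ∀ m n → m ∸ n ≡ (m ⊔ n) ∸ n
m∸n≡[m⊔n]∸n m n = sym (trans (∸-distribʳ-⊔ n m n) (trans (cong ((m ∸ n) ⊔_) (n∸n≡0 n)) (⊔-identityʳ (m ∸ n))))

m∸n≡m∸[m⊓n] : ∀ m n → m ∸ n ≡ m ∸ (m ⊓ n)
m∸n≡m∸[m⊓n] m n = sym (trans (∸-distribˡ-⊓-⊔ m m n) (cong (_⊔ (m ∸ n)) (n∸n≡0 m)))

m≤o⇒[m⊔n]∸o≡n∸o : ∀ {m n o} → m ≤ o → (m ⊔ n) ∸ o ≡ n ∸ o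
m≤o⇒[m⊔n]∸o≡n∸o {m} {n} {o} m≤o = trans (∸-distribʳ-⊔ o m n) (cong (_⊔ (n ∸ o)) (m≤n⇒m∸n≡0 m≤o))

m<m⊔n⇒m<n : ∀ {m n} → m < m ⊔ n → m < n
m<m⊔n⇒m<n {m} {n} lt with ≤-total n m
... | inj₁ n≤m rewrite m≥n⇒m⊔n≡m n≤m = contradiction lt (<-irrefl refl)
... | inj₂ m≤n rewrite m≤n⇒m⊔n≡n m≤n = lt

m⊓n<n⇒m<n : ∀ {m n} → m ⊓ n < n → m < n
m⊓n<n⇒m<n {m} {n} lt with ≤-total m n
... | inj₁ m≤n rewrite m≤n⇒m⊓n≡m m≤n = lt
... | inj₂ n≤m rewrite m≥n⇒m⊓n≡n n≤m = contradiction lt (<-irrefl refl)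

m≥n⇒m⊔[n⊔o]≡m⊔o : ∀ {m n o} → n ≤ m → m ⊔ (n ⊔ o) ≡ m ⊔ o
m≥n⇒m⊔[n⊔o]≡m⊔o {m} {n} {o} n≤m = trans (sym (⊔-assoc m n o)) (cong (_⊔ o) (m≥n⇒m⊔n≡m n≤m))

o≤n⇒m⊓o≡[m⊓n]⊓o : ∀ {m n o} → o ≤ n → m ⊓ o ≡ (m ⊓ n) ⊓ o
o≤n⇒m⊓o≡[m⊓n]⊓o {m} {n} {o} o≤n = trans (cong (m ⊓_) (sym (m≥n⇒m⊓n≡n o≤n))) (sym (⊓-assoc m n o))

∸-telescope : ∀ {m n o} → m ≤ n → n ≤ o → (o ∸ n) + (n ∸ m) ≡ o ∸ m
∸-telescope {m} {n} {o} m≤n n≤o = begin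
  (o ∸ n) + (n ∸ m)           ≡⟨ +-comm (o ∸ n) (n ∸ m) ⟩
  (n ∸ m) + (o ∸ n)           ≡⟨ sym (m+n∸m≡n m _) ⟩
  m + ((n ∸ m) + (o ∸ n)) ∸ m ≡⟨ cong (_∸ m) (sym (+-assoc m (n ∸ m) (o ∸ n))) ⟩
  m + (n ∸ m) + (o ∸ n) ∸ m   ≡⟨ cong (λ z → z + (o ∸ n) ∸ m) (m+[n∸m]≡n m≤n) ⟩
  n + (o ∸ n) ∸ m             ≡⟨ cong (_∸ m) (m+[n∸m]≡n n≤o) ⟩
  o ∸ m                       ∎
  where open ≡-Reasoning

∸-telescope-⊓ : ∀ {m n o} → m ≤ n → m ≤ o → (o ∸ n) + ((o ⊓ n) ∸ m) ≡ o ∸ m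
∸-telescope-⊓ {m} {n} {o} m≤n m≤o with ≤-total o n
... | inj₁ o≤n rewrite m≤n⇒m∸n≡0 o≤n | m≤n⇒m⊓n≡m o≤n = refl
... | inj₂ n≤o rewrite m≥n⇒m⊓n≡n n≤o = ∸-telescope m≤n n≤o

∸-telescope-⊓⊓ : ∀ {m n o} → o ≤ n → (m ∸ (m ⊓ n)) + ((m ⊓ n) ∸ o) ≡ m ∸ (m ⊓ o)
∸-telescope-⊓⊓ {m} {n} {o} o≤n with ≤-total m o
... | inj₁ m≤o rewrite m≤n⇒m⊓n≡m m≤o | m≤n⇒m⊓n≡m (≤-trans m≤o o≤n) | n∸n≡0 m | m≤n⇒m∸n≡0 m≤o = refl
... | inj₂ o≤m with ≤-total m n
...   | inj₁ m≤n rewrite m≤n⇒m⊓n≡m m≤n | m≥n⇒m⊓n≡n o≤m | n∸n≡0 m = refl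
...   | inj₂ n≤m rewrite m≥n⇒m⊓n≡n n≤m | m≥n⇒m⊓n≡n o≤m = ∸-telescope o≤n n≤m

m+[o∸n]+[n∸m]≡o : ∀ {m n o} → m ≤ n → n ≤ o → m + (o ∸ n) + (n ∸ m) ≡ o
m+[o∸n]+[n∸m]≡o {m} {n} {o} m≤n n≤o = begin
  m + (o ∸ n) + (n ∸ m)   ≡⟨ +-assoc m (o ∸ n) (n ∸ m) ⟩
  m + ((o ∸ n) + (n ∸ m)) ≡⟨ cong (m +_) (∸-telescope m≤n n≤o) ⟩
  m + (o ∸ m)             ≡⟨ m+[n∸m]≡n (≤-trans m≤n n≤o) ⟩
  o                       ∎
  where open ≡-Reasoning

[m+o]∸[n+o]≡m∸n : ∀ m o n → (m + o) ∸ (n + o) ≡ m ∸ n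
[m+o]∸[n+o]≡m∸n m o n = trans (cong₂ _∸_ (+-comm m o) (+-comm n o)) ([m+n]∸[m+o]≡n∸o o m n)

[b⊓d∸a]+[d⊓c∸b]≡d⊓c∸a : ∀ {a b c d} → a ≤ b → b ≤ c → a ≤ d → ((b ⊓ d) ∸ a) + ((d ⊓ c) ∸ b) ≡ (d ⊓ c) ∸ a
[b⊓d∸a]+[d⊓c∸b]≡d⊓c∸a {a} {b} {c} {d} a≤b b≤c a≤d with ≤-total b d
... | inj₁ b≤d rewrite m≤n⇒m⊓n≡m b≤d = trans (+-comm (b ∸ a) _) (∸-telescope a≤b (⊓-glb b≤d b≤c))
... | inj₂ d≤b rewrite m≥n⇒m⊓n≡n d≤b | m≤n⇒m⊓n≡m (≤-trans d≤b b≤c) | m≤n⇒m∸n≡0 d≤b = +-identityʳ _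

[c∸b⊔d]+[b∸d⊔a]≡c∸a⊔d : ∀ {a b c d} → a ≤ b → b ≤ c → d ≤ c → (c ∸ (b ⊔ d)) + (b ∸ (d ⊔ a)) ≡ c ∸ (a ⊔ d)
[c∸b⊔d]+[b∸d⊔a]≡c∸a⊔d {a} {b} {c} {d} a≤b b≤c d≤c with ≤-total b (d ⊔ a)
... | inj₂ d⊔a≤b rewrite m≥n⇒m⊔n≡m (≤-trans (m≤m⊔n d a) d⊔a≤b) | ⊔-comm a d = ∸-telescope d⊔a≤b b≤c
... | inj₁ b≤d⊔a rewrite m≤n⇒m∸n≡0 b≤d⊔a | +-identityʳ (c ∸ (b ⊔ d)) = cong (c ∸_) b⊔d≡a⊔d
  where
    b⊔d≡a⊔d : b ⊔ d ≡ a ⊔ d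
    b⊔d≡a⊔d with ≤-total d a
    ... | inj₁ d≤a = trans (m≥n⇒m⊔n≡m (≤-trans d≤a a≤b))
                     (trans (≤-antisym (subst (b ≤_) (m≤n⇒m⊔n≡n d≤a) b≤d⊔a) a≤b) (sym (m≥n⇒m⊔n≡m d≤a)))
    ... | inj₂ a≤d = trans (m≤n⇒m⊔n≡n (subst (b ≤_) (m≥n⇒m⊔n≡m a≤d) b≤d⊔a)) (sym (m≤n⇒m⊔n≡n a≤d))

[a+s]∸e∸[q+s]≡a∸[q+e] : ∀ a s e q → ((a + s) ∸ e) ∸ (q + s) ≡ a ∸ (q + e)
[a+s]∸e∸[q+s]≡a∸[q+e] a s e q = begin
  (a + s) ∸ e ∸ (q + s)   ≡⟨ ∸-+-assoc (a + s) e (q + s) ⟩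
  (a + s) ∸ (e + (q + s)) ≡⟨ cong ((a + s) ∸_) (solve 3 (λ e q s → e :+ (q :+ s) := q :+ e :+ s) refl e q s) ⟩
  (a + s) ∸ (q + e + s)   ≡⟨ [m+o]∸[n+o]≡m∸n a s (q + e) ⟩
  a ∸ (q + e)             ∎
  where open ≡-Reasoning

m∸n≡1+[m∸1+n] : ∀ {m n} → n < m → m ∸ n ≡ suc (m ∸ suc n)
m∸n≡1+[m∸1+n] {suc m} {zero}  _   = refl
m∸n≡1+[m∸1+n] {suc m} {suc n} n<m = m∸n≡1+[m∸1+n] (≤-pred n<m)

<ᵇ-true : ∀ {m n} → m < n → (m <ᵇ n) ≡ true
<ᵇ-true m<n = Equivalence.to T-≡ (<⇒<ᵇ m<n)

<ᵇ-false : ∀ {m n} → n ≤ m → (m <ᵇ n) ≡ false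
<ᵇ-false {m} {n} n≤m with m <ᵇ n in eq
... | true  = contradiction (<ᵇ⇒< m n (subst T (sym eq) tt)) (≤⇒≯ n≤m)
... | false = refl

antitone-≤ : ∀ (f : ℕ → ℕ) n → (∀ i → suc i < n → f (suc i) ≤ f i) → ∀ {i k} → i ≤ k → k < n → f k ≤ f i
antitone-≤ f n dec {i} {k} i≤k k<n with m≤n⇒m<n∨m≡n i≤k
... | inj₂ refl = ≤-refl
antitone-≤ f n dec {i} {suc k} i≤k k<n | inj₁ i<k =
  ≤-trans (dec k k<n) (antitone-≤ f n dec (≤-pred i<k) (<-trans (n<1+n k) k<n))

clamp : ℕ → ℕ → ℕ → ℕ
clamp lo s hi = lo ⊔ (s ⊓ hi)

clamp-lo : ∀ {lo s hi} → s ≤ lo → clamp lo s hi ≡ lo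
clamp-lo {lo} {s} {hi} s≤lo = m≥n⇒m⊔n≡m (≤-trans (m⊓n≤m s hi) s≤lo)

clamp-hi : ∀ {lo s hi} → lo ≤ hi → hi ≤ s → clamp lo s hi ≡ hi
clamp-hi {lo} {s} {hi} lo≤hi hi≤s rewrite m≥n⇒m⊓n≡n hi≤s = m≤n⇒m⊔n≡n lo≤hi

clamp-mid : ∀ {lo s hi} → lo ≤ s → s ≤ hi → clamp lo s hi ≡ s
clamp-mid {lo} {s} {hi} lo≤s s≤hi rewrite m≤n⇒m⊓n≡m s≤hi = m≤n⇒m⊔n≡n lo≤s

lo≤clamp : ∀ lo s hi → lo ≤ clamp lo s hi
lo≤clamp lo s hi = m≤m⊔n lo (s ⊓ hi)

clamp≤hi : ∀ lo s hi → lo ≤ hi → clamp lo s hi ≤ hi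
clamp≤hi lo s hi lo≤hi = ⊔-lub lo≤hi (m⊓n≤n s hi)

clamp-unique : ∀ {lo x hi s} → lo ≤ x → x ≤ hi → (lo < x → x ≤ s) → (x < hi → s ≤ x) → x ≡ clamp lo s hi
clamp-unique {lo} {x} {hi} {s} lo≤x x≤hi above below with m≤n⇒m<n∨m≡n lo≤x | m≤n⇒m<n∨m≡n x≤hi
... | inj₁ lo<x | inj₁ x<hi = sym (trans (clamp-mid (≤-trans lo≤x (above lo<x)) (≤-trans (below x<hi) x≤hi))
                                         (≤-antisym (below x<hi) (above lo<x)))
... | inj₁ lo<x | inj₂ refl = sym (clamp-hi lo≤x (above lo<x))
... | inj₂ refl | inj₁ x<hi = sym (clamp-lo (below x<hi))
... | inj₂ refl | inj₂ refl = sym (m≥n⇒m⊔n≡m (m⊓n≤n s x))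

clamp-⊓ : ∀ {lo s hi hi′} → lo ≤ hi′ → hi′ ≤ hi → clamp lo s hi ⊓ hi′ ≡ clamp lo s hi′
clamp-⊓ {lo} {s} {hi} {hi′} lo≤hi′ hi′≤hi with ≤-total s hi′
... | inj₁ s≤hi′ rewrite m≤n⇒m⊓n≡m (≤-trans s≤hi′ hi′≤hi) | m≤n⇒m⊓n≡m s≤hi′ = m≤n⇒m⊓n≡m (⊔-lub lo≤hi′ s≤hi′)
... | inj₂ hi′≤s rewrite m≥n⇒m⊓n≡n hi′≤s | m≤n⇒m⊔n≡n lo≤hi′ = begin
  (lo ⊔ (s ⊓ hi)) ⊓ hi′ ≡⟨ ⊓-distribʳ-⊔ hi′ lo (s ⊓ hi) ⟩
  (lo ⊓ hi′) ⊔ ((s ⊓ hi) ⊓ hi′) ≡⟨ cong₂ _⊔_ (m≤n⇒m⊓n≡m lo≤hi′) (sym (o≤n⇒m⊓o≡[m⊓n]⊓o hi′≤hi)) ⟩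
  lo ⊔ (s ⊓ hi′) ≡⟨ cong (lo ⊔_) (m≥n⇒m⊓n≡n hi′≤s) ⟩
  lo ⊔ hi′ ≡⟨ m≤n⇒m⊔n≡n lo≤hi′ ⟩
  hi′ ∎
  where open ≡-Reasoning

mirror : ℕ → ℕ → ℕ → ℕ
mirror lo hi s = (hi + lo) ∸ s

mirror-involutive : ∀ {lo hi s} → s ≤ hi → mirror lo hi (mirror lo hi s) ≡ s
mirror-involutive {lo} {hi} {s} s≤hi = m∸[m∸n]≡n (≤-trans s≤hi (m≤m+n hi lo))

lo≤mirror : ∀ {lo hi s} → s ≤ hi → lo ≤ mirror lo hi s
lo≤mirror {lo} {hi} {s} s≤hi = m+n≤o⇒m≤o∸n lo (subst (_≤ hi + lo) (+-comm s lo) (+-monoˡ-≤ lo s≤hi))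

mirror≤hi : ∀ {lo hi s} → lo ≤ s → mirror lo hi s ≤ hi
mirror≤hi {lo} {hi} {s} lo≤s = ≤-trans (∸-monoʳ-≤ (hi + lo) lo≤s) (≤-reflexive (m+n∸n≡m hi lo))

mirror∸lo : ∀ lo hi s → mirror lo hi s ∸ lo ≡ hi ∸ s
mirror∸lo lo hi s = begin
  (hi + lo) ∸ s ∸ lo   ≡⟨ ∸-+-assoc (hi + lo) s lo ⟩
  (hi + lo) ∸ (s + lo) ≡⟨ [m+o]∸[n+o]≡m∸n hi lo s ⟩
  hi ∸ s               ∎
  where open ≡-Reasoning

hi∸mirror : ∀ {lo hi s} → s ≤ hi → hi ∸ mirror lo hi s ≡ s ∸ lo
hi∸mirror {lo} {hi} {s} s≤hi = begin
  hi ∸ mirror lo hi s                ≡⟨ sym (mirror∸lo lo hi (mirror lo hi s)) ⟩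
  mirror lo hi (mirror lo hi s) ∸ lo ≡⟨ cong (_∸ lo) (mirror-involutive s≤hi) ⟩
  s ∸ lo                             ∎
  where open ≡-Reasoning

sumTo : ℕ → (ℕ → ℕ) → ℕ
sumTo zero    f = 0
sumTo (suc n) f = sumTo n f + f n

sumTo-cong : ∀ n {f g : ℕ → ℕ} → (∀ i → i < n → f i ≡ g i) → sumTo n f ≡ sumTo n g
sumTo-cong zero    eq = refl
sumTo-cong (suc n) eq = cong₂ _+_ (sumTo-cong n (λ i i<n → eq i (m<n⇒m<1+n i<n))) (eq n ≤-refl)

sumTo-distrib-+ : ∀ n (f g : ℕ → ℕ) → sumTo n f + sumTo n g ≡ sumTo n (λ i → f i + g i)
sumTo-distrib-+ zero    f g = refl
sumTo-distrib-+ (suc n) f g =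
  trans (interchange (sumTo n f) (f n) (sumTo n g) (g n)) (cong (_+ (f n + g n)) (sumTo-distrib-+ n f g))

indicator : Bool → ℕ
indicator b = if b then 1 else 0

count-cong : ∀ n {f g : ℕ → Bool} → (∀ j → j < n → f j ≡ g j) → count f n ≡ count g n
count-cong zero    eq = refl
count-cong (suc n) eq = cong₂ _+_ (count-cong n (λ j j<n → eq j (m<n⇒m<1+n j<n))) (cong indicator (eq n ≤-refl))

count-false : ∀ n → count (λ _ → false) n ≡ 0
count-false zero    = refl
count-false (suc n) = trans (+-identityʳ _) (count-false n)

count-+ : ∀ n {f g h : ℕ → Bool} → (∀ j → indicator (h j) ≡ indicator (f j) + indicator (g j)) →
          count h n ≡ count f n + count g n
count-+ zero    eq = refl
count-+ (suc n) {f} {g} eq =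
  trans (cong₂ _+_ (count-+ n eq) (eq n)) (interchange (count f n) (count g n) (indicator (f n)) (indicator (g n)))

count-∨ : ∀ n (f g : ℕ → Bool) → count (λ j → f j ∨ g j) n ≡ count f n + count (λ j → g j ∧ not (f j)) n
count-∨ n f g = count-+ n (λ j → pointwise (f j) (g j))
  where
    pointwise : ∀ a b → indicator (a ∨ b) ≡ indicator a + indicator (b ∧ not a)
    pointwise true  b     rewrite ∧-zeroʳ b = refl
    pointwise false true  = refl
    pointwise false false = refl

count-∧-not+count-∧ : ∀ n (f g : ℕ → Bool) → count (λ j → f j ∧ not (g j)) n + count (λ j → f j ∧ g j) n ≡ count f n
count-∧-not+count-∧ n f g = sym (count-+ n (λ j → pointwise (f j) (g j)))
  where
    pointwise : ∀ a b → indicator a ≡ indicator (a ∧ not b) + indicator (a ∧ b)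
    pointwise true  true  = refl
    pointwise true  false = refl
    pointwise false b     = refl

inRange : ℕ → ℕ → ℕ → Bool
inRange a b j = not (j <ᵇ a) ∧ (j <ᵇ b)

inRange-inside : ∀ {a b j} → a ≤ j → j < b → inRange a b j ≡ true
inRange-inside a≤j j<b rewrite <ᵇ-false a≤j | <ᵇ-true j<b = refl

inRange-below : ∀ {a b j} → j < a → inRange a b j ≡ false
inRange-below j<a rewrite <ᵇ-true j<a = refl

inRange-above : ∀ {a b j} → b ≤ j → inRange a b j ≡ false
inRange-above {a} {b} {j} b≤j rewrite <ᵇ-false b≤j = ∧-zeroʳ (not (j <ᵇ a))

inRange-sound : ∀ {a b j} → inRange a b j ≡ true → a ≤ j × j < b
inRange-sound {a} {b} {j} eq with j <? a | j <? b
... | yes j<a | _      = contradiction (trans (sym (inRange-below {a} {b} j<a)) eq) (λ ())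
... | no j≮a  | no j≮b = contradiction (trans (sym (inRange-above {a} {b} (≮⇒≥ j≮b))) eq) (λ ())
... | no j≮a  | yes j<b = ≮⇒≥ j≮a , j<b

inRange-∧ : ∀ a b c d j → (inRange a b j ∧ inRange c d j) ≡ inRange (a ⊔ c) (b ⊓ d) j
inRange-∧ a b c d j with j <? a | j <? b | j <? c | j <? d
... | yes j<a | _ | _ | _
  rewrite inRange-below {a} {b} j<a | inRange-below {a ⊔ c} {b ⊓ d} (≤-trans j<a (m≤m⊔n a c)) = refl
... | no j≮a | no j≮b | _ | _
  rewrite inRange-above {a} {b} (≮⇒≥ j≮b) | inRange-above {a ⊔ c} {b ⊓ d} (≤-trans (m⊓n≤m b d) (≮⇒≥ j≮b)) = refl
... | no j≮a | yes j<b | yes j<c | _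
  rewrite inRange-inside {a} {b} (≮⇒≥ j≮a) j<b | inRange-below {c} {d} j<c
        | inRange-below {a ⊔ c} {b ⊓ d} (≤-trans j<c (m≤n⊔m a c)) = refl
... | no j≮a | yes j<b | no j≮c | no j≮d
  rewrite inRange-inside {a} {b} (≮⇒≥ j≮a) j<b | inRange-above {c} {d} (≮⇒≥ j≮d)
        | inRange-above {a ⊔ c} {b ⊓ d} (≤-trans (m⊓n≤n b d) (≮⇒≥ j≮d)) = refl
... | no j≮a | yes j<b | no j≮c | yes j<d
  rewrite inRange-inside {a} {b} (≮⇒≥ j≮a) j<b | inRange-inside {c} {d} (≮⇒≥ j≮c) j<d
        | inRange-inside {a ⊔ c} {b ⊓ d} (⊔-lub (≮⇒≥ j≮a) (≮⇒≥ j≮c)) (⊓-glb j<b j<d) = refl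

inRange-⊓ : ∀ a b c {j} → j < c → inRange a b j ≡ inRange a (b ⊓ c) j
inRange-⊓ a b c {j} j<c = trans (sym (∧-identityʳ (inRange a b j)))
  (trans (cong (inRange a b j ∧_) (sym (inRange-inside {0} {c} z≤n j<c))) (trans (inRange-∧ a b 0 c j) (cong (λ z → inRange z (b ⊓ c) j) (⊔-identityʳ a))))

count-inRange : ∀ a b n → count (inRange a b) n ≡ (b ⊓ n) ∸ a
count-inRange a b zero = sym (trans (cong (_∸ a) (⊓-zeroʳ b)) (0∸n≡0 a))
count-inRange a b (suc n) rewrite count-inRange a b n with n <? a | n <? b
... | yes n<a | _ rewrite inRange-below {a} {b} n<a | +-identityʳ ((b ⊓ n) ∸ a) =
  trans (m≤n⇒m∸n≡0 (≤-trans (m⊓n≤n b n) (<⇒≤ n<a))) (sym (m≤n⇒m∸n≡0 (≤-trans (m⊓n≤n b (suc n)) n<a)))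
... | no n≮a | yes n<b
  rewrite inRange-inside {a} {b} (≮⇒≥ n≮a) n<b | m≥n⇒m⊓n≡n (<⇒≤ n<b) | m≥n⇒m⊓n≡n n<b =
  trans (+-comm (n ∸ a) 1) (sym (+-∸-assoc 1 (≮⇒≥ n≮a)))
... | no n≮a | no n≮b
  rewrite inRange-above {a} {b} (≮⇒≥ n≮b) | m≤n⇒m⊓n≡m (≮⇒≥ n≮b) | m≤n⇒m⊓n≡m (≤-trans (≮⇒≥ n≮b) (n≤1+n n)) =
  +-identityʳ _

anyBelow-cong : ∀ n {f g : ℕ → Bool} → (∀ i → i < n → f i ≡ g i) → anyBelow f n ≡ anyBelow g n
anyBelow-cong zero    eq = refl
anyBelow-cong (suc n) eq = cong₂ _∨_ (anyBelow-cong n (λ i i<n → eq i (m<n⇒m<1+n i<n))) (eq n ≤-refl)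

anyBelow-true : ∀ (f : ℕ → Bool) {i n} → f i ≡ true → i < n → anyBelow f n ≡ true
anyBelow-true f {i} {suc n} fi i<1+n with m≤n⇒m<n∨m≡n (≤-pred i<1+n)
... | inj₁ i<n  rewrite anyBelow-true f fi i<n = refl
... | inj₂ refl rewrite fi = ∨-zeroʳ (anyBelow f i)

anyBelow-false : ∀ (f : ℕ → Bool) n → (∀ i → i < n → f i ≡ false) → anyBelow f n ≡ false
anyBelow-false f zero    none = refl
anyBelow-false f (suc n) none
  rewrite anyBelow-false f n (λ i i<n → none i (m<n⇒m<1+n i<n)) | none n ≤-refl = refl

prev : ℕ → (ℕ → ℕ) → ℕ → ℕ
prev N lo zero    = N
prev N lo (suc i) = lo i

module Staircase (lo hi : ℕ → ℕ) (N : ℕ) where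

  covered : ℕ → ℕ → Bool
  covered n j = anyBelow (λ i → inRange (lo i) (hi i) j) n

  fresh : ∀ n {j} → (∀ i → suc i < suc n → lo (suc i) ≤ lo i) → (∀ i → suc i < suc n → hi (suc i) ≤ hi i) → j < N →
          (inRange (lo n) (hi n) j ∧ not (covered n j)) ≡ inRange (lo n) (hi n ⊓ prev N lo n) j
  fresh zero    {j} _ _ j<N = trans (∧-identityʳ _) (inRange-⊓ (lo 0) (hi 0) N j<N)
  fresh (suc n) {j} lo↓ hi↓ _ with j <? lo n
  ... | yes j<lo = trans (cong (λ b → inRange (lo (suc n)) (hi (suc n)) j ∧ not b) uncovered)
                         (trans (∧-identityʳ _) (inRange-⊓ (lo (suc n)) (hi (suc n)) (lo n) j<lo))
    where
      uncovered : covered (suc n) j ≡ false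
      uncovered = anyBelow-false _ (suc n) (λ i i<1+n →
        inRange-below {lo i} {hi i} (≤-trans j<lo (antitone-≤ lo (suc (suc n)) lo↓ (≤-pred i<1+n) (m<n⇒m<1+n (n<1+n n)))))
  ... | no j≮lo = trans shadowed (sym (inRange-above {lo (suc n)} (≤-trans (m⊓n≤n (hi (suc n)) (lo n)) (≮⇒≥ j≮lo))))
    where
      shadowed : (inRange (lo (suc n)) (hi (suc n)) j ∧ not (covered (suc n) j)) ≡ false
      shadowed with inRange (lo (suc n)) (hi (suc n)) j in eq
      ... | false = refl
      ... | true rewrite anyBelow-true (λ i → inRange (lo i) (hi i) j) {n}
                           (inRange-inside {lo n} {hi n} (≮⇒≥ j≮lo) (≤-trans (proj₂ (inRange-sound {lo (suc n)} {hi (suc n)} eq)) (hi↓ n ≤-refl))) ≤-refl = refl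

  count-covered : ∀ n → (∀ i → suc i < n → lo (suc i) ≤ lo i) → (∀ i → suc i < n → hi (suc i) ≤ hi i) →
                  (∀ i → i < n → hi i ≤ N) → count (covered n) N ≡ sumTo n (λ i → (hi i ⊓ prev N lo i) ∸ lo i)
  count-covered zero    lo↓ hi↓ hi≤N = count-false N
  count-covered (suc n) lo↓ hi↓ hi≤N = begin
    count (covered (suc n)) N
      ≡⟨ count-∨ N (covered n) (inRange (lo n) (hi n)) ⟩
    count (covered n) N + count (λ j → inRange (lo n) (hi n) j ∧ not (covered n j)) N
      ≡⟨ cong₂ _+_ (count-covered n (λ i → lo↓ i ∘ m<n⇒m<1+n) (λ i → hi↓ i ∘ m<n⇒m<1+n) (λ i → hi≤N i ∘ m<n⇒m<1+n))
                   (count-cong N (λ j → fresh n lo↓ hi↓)) ⟩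
    sumTo n _ + count (inRange (lo n) (hi n ⊓ prev N lo n)) N
      ≡⟨ cong (sumTo n _ +_) (count-inRange (lo n) (hi n ⊓ prev N lo n) N) ⟩
    sumTo n _ + ((hi n ⊓ prev N lo n) ⊓ N ∸ lo n)
      ≡⟨ cong (λ z → sumTo n _ + (z ∸ lo n)) (m≤n⇒m⊓n≡m (≤-trans (m⊓n≤m (hi n) _) (hi≤N n ≤-refl))) ⟩
    sumTo (suc n) (λ i → (hi i ⊓ prev N lo i) ∸ lo i) ∎
    where open ≡-Reasoning

  sumTo-byTop≡sumTo-byBottom : ∀ n → hi 0 ≤ N → (∀ i → i < n → lo i ≤ hi i) → (∀ i → i < n → lo i ≤ prev N lo i) →
    (∀ i → i < n → hi (suc i) ≤ hi i) →
    sumTo n (λ i → (hi i ⊓ prev N lo i) ∸ lo i) ≡ sumTo n (λ i → hi i ∸ (lo i ⊔ hi (suc i))) + (hi n ∸ prev N lo n)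
  sumTo-byTop≡sumTo-byBottom zero    hi≤N _     _      _    = sym (m≤n⇒m∸n≡0 hi≤N)
  sumTo-byTop≡sumTo-byBottom (suc n) hi≤N lo≤hi lo≤prev hi↓ = begin
    sumTo n top + top n
      ≡⟨ cong (_+ top n) (sumTo-byTop≡sumTo-byBottom n hi≤N (λ i → lo≤hi i ∘ m<n⇒m<1+n) (λ i → lo≤prev i ∘ m<n⇒m<1+n) (λ i → hi↓ i ∘ m<n⇒m<1+n)) ⟩
    sumTo n bottom + (hi n ∸ prev N lo n) + top n
      ≡⟨ +-assoc (sumTo n bottom) _ _ ⟩
    sumTo n bottom + ((hi n ∸ prev N lo n) + top n)
      ≡⟨ cong (sumTo n bottom +_) (∸-telescope-⊓ (lo≤prev n ≤-refl) (lo≤hi n ≤-refl)) ⟩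
    sumTo n bottom + (hi n ∸ lo n)
      ≡⟨ cong (sumTo n bottom +_) (sym split) ⟩
    sumTo n bottom + (bottom n + (hi (suc n) ∸ lo n))
      ≡⟨ sym (+-assoc (sumTo n bottom) _ _) ⟩
    sumTo (suc n) bottom + (hi (suc n) ∸ lo n) ∎
    where
      open ≡-Reasoning
      top bottom : ℕ → ℕ
      top i = (hi i ⊓ prev N lo i) ∸ lo i
      bottom i = hi i ∸ (lo i ⊔ hi (suc i))
      split : bottom n + (hi (suc n) ∸ lo n) ≡ hi n ∸ lo n
      split with ≤-total (hi (suc n)) (lo n)
      ... | inj₁ hi′≤lo rewrite m≥n⇒m⊔n≡m hi′≤lo | m≤n⇒m∸n≡0 hi′≤lo = +-identityʳ _
      ... | inj₂ lo≤hi′ rewrite m≤n⇒m⊔n≡n lo≤hi′ = ∸-telescope lo≤hi′ (hi↓ n ≤-refl)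

  sumTo-byTop≡sumTo-byBottom-0 : ∀ n → hi n ≡ 0 → hi 0 ≤ N → (∀ i → i < n → lo i ≤ hi i) → (∀ i → i < n → lo i ≤ prev N lo i) →
    (∀ i → i < n → hi (suc i) ≤ hi i) →
    sumTo n (λ i → (hi i ⊓ prev N lo i) ∸ lo i) ≡ sumTo n (λ i → hi i ∸ (lo i ⊔ hi (suc i)))
  sumTo-byTop≡sumTo-byBottom-0 n hi≡0 hi≤N lo≤hi lo≤prev hi↓ =
    trans (sumTo-byTop≡sumTo-byBottom n hi≤N lo≤hi lo≤prev hi↓)
          (trans (cong (λ z → sumTo n (λ i → hi i ∸ (lo i ⊔ hi (suc i))) + (z ∸ prev N lo n)) hi≡0)
                 (trans (cong (sumTo n (λ i → hi i ∸ (lo i ⊔ hi (suc i))) +_) (0∸n≡0 (prev N lo n))) (+-identityʳ _)))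

-- Descending paths and blockwise mirroring

module Downward (m : ℕ) where

  -- foldDown step k = step k (step (k + 1) (⋯ (step (m ∸ 1) 0)))
  iterate : (ℕ → ℕ → ℕ) → ℕ → ℕ → ℕ
  iterate step zero    k = 0
  iterate step (suc d) k = step k (iterate step d (suc k))

  foldDown : (ℕ → ℕ → ℕ) → ℕ → ℕ
  foldDown step k = iterate step (m ∸ k) k

  foldDown-step : ∀ step {k} → k < m → foldDown step k ≡ step k (foldDown step (suc k))
  foldDown-step step k<m rewrite m∸n≡1+[m∸1+n] k<m = refl

  foldDown-cong : ∀ step step′ → (∀ i acc → i < m → step i acc ≡ step′ i acc) → ∀ k → foldDown step k ≡ foldDown step′ k
  foldDown-cong step step′ eq k = go (m ∸ k) k ≤-refl
    where
      go : ∀ d k → d ≤ m ∸ k → iterate step d k ≡ iterate step′ d k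
      go zero    k _     = refl
      go (suc d) k 1+d≤ = trans (cong (step k) (go d (suc k) d≤)) (eq k _ k<m)
        where
          k<m : k < m
          k<m = m∸n≢0⇒n<m (λ m∸k≡0 → contradiction (subst (suc d ≤_) m∸k≡0 1+d≤) λ ())
          d≤ : d ≤ m ∸ suc k
          d≤ = ≤-pred (subst (suc d ≤_) (m∸n≡1+[m∸1+n] k<m) 1+d≤)

  downward-induction : (P : ℕ → Set) → (∀ k → k < m → (suc k < m → P (suc k)) → P k) → ∀ k → k < m → P k
  downward-induction P step k k<m = go (m ∸ suc k) k k<m refl
    where
      go : ∀ d k → k < m → m ∸ suc k ≡ d → P k
      go zero    k k<m eq = step k k<m (λ 1+k<m → contradiction eq (m>n⇒m∸n≢0 1+k<m))
      go (suc d) k k<m eq = step k k<m (λ 1+k<m →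
        go d (suc k) 1+k<m (suc-injective (trans (sym (m∸n≡1+[m∸1+n] 1+k<m)) eq)))

record Path (m : ℕ) (F H x : ℕ → ℕ) : Set where
  field
    lower : ∀ k → k < m → F (suc k) ≤ x k
    upper : ∀ k → k < m → x k ≤ H k
    glue  : ∀ k → suc k < m → F (suc k) ⊔ x (suc k) ≡ x k ⊓ H (suc k)

module Reflection (m : ℕ) (F H : ℕ → ℕ) where
  open Downward m

  isCut : ℕ → Bool
  isCut b = F b ≡ᵇ H b

  isCut⇒≡ : ∀ {b} → isCut b ≡ true → F b ≡ H b
  isCut⇒≡ {b} cut = ≡ᵇ⇒≡ (F b) (H b) (subst T (sym cut) tt)

  ¬isCut⇒≢ : ∀ {b} → isCut b ≡ false → F b ≢ H b
  ¬isCut⇒≢ {b} ¬cut eq = subst T ¬cut (≡⇒≡ᵇ (F b) (H b) eq)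

  α γ : (ℕ → ℕ) → ℕ → ℕ
  α x k = F k ∸ x k
  γ x k = x k ∸ H (suc k)

  sumSinceCut : (ℕ → ℕ) → ℕ → ℕ
  sumSinceCut f zero    = 0
  sumSinceCut f (suc k) = if isCut (suc k) then 0 else sumSinceCut f k + f k

  sumUntilCut : (ℕ → ℕ) → ℕ → ℕ
  sumUntilCut f = foldDown (λ k acc → f k + (if isCut (suc k) then 0 else acc))

  blockTop : ℕ → ℕ
  blockTop zero    = H 0
  blockTop (suc k) = if isCut (suc k) then H (suc k) else blockTop k

  blockBottom : ℕ → ℕ
  blockBottom = foldDown (λ k acc → if isCut (suc k) then F (suc k) else acc)

  level : (ℕ → ℕ) → ℕ → ℕ
  level x k = blockBottom k + sumSinceCut (γ x) k + sumUntilCut (γ x) k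

  flip : (ℕ → ℕ) → ℕ → ℕ
  flip x k = clamp (F (suc k)) (mirror (blockBottom k) (blockTop k) (level x k)) (H k)

  module _ {k : ℕ} (cut : isCut (suc k) ≡ true) where

    sumSinceCut-cut : ∀ f → sumSinceCut f (suc k) ≡ 0
    sumSinceCut-cut f rewrite cut = refl

    blockTop-cut : blockTop (suc k) ≡ H (suc k)
    blockTop-cut rewrite cut = refl

    sumUntilCut-cut : ∀ f → k < m → sumUntilCut f k ≡ f k
    sumUntilCut-cut f k<m rewrite foldDown-step (λ k acc → f k + (if isCut (suc k) then 0 else acc)) k<m | cut =
      +-identityʳ (f k)

    blockBottom-cut : k < m → blockBottom k ≡ F (suc k)
    blockBottom-cut k<m rewrite foldDown-step (λ k acc → if isCut (suc k) then F (suc k) else acc) k<m | cut = refl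

  module _ {k : ℕ} (¬cut : isCut (suc k) ≡ false) where

    sumSinceCut-noCut : ∀ f → sumSinceCut f (suc k) ≡ sumSinceCut f k + f k
    sumSinceCut-noCut f rewrite ¬cut = refl

    blockTop-noCut : blockTop (suc k) ≡ blockTop k
    blockTop-noCut rewrite ¬cut = refl

    sumUntilCut-noCut : ∀ f → k < m → sumUntilCut f k ≡ f k + sumUntilCut f (suc k)
    sumUntilCut-noCut f k<m rewrite foldDown-step (λ k acc → f k + (if isCut (suc k) then 0 else acc)) k<m | ¬cut = refl

    blockBottom-noCut : k < m → blockBottom k ≡ blockBottom (suc k)
    blockBottom-noCut k<m rewrite foldDown-step (λ k acc → if isCut (suc k) then F (suc k) else acc) k<m | ¬cut = refl

    level-noCut : ∀ x → k < m → level x (suc k) ≡ level x k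
    level-noCut x k<m rewrite sumSinceCut-noCut (γ x) | sumUntilCut-noCut (γ x) k<m | blockBottom-noCut k<m =
      solve 4 (λ b d g u → b :+ (d :+ g) :+ u := b :+ d :+ (g :+ u)) refl
        (blockBottom (suc k)) (sumSinceCut (γ x) k) (γ x k) (sumUntilCut (γ x) (suc k))

  sumSinceCut-cong : ∀ {f g} k → (∀ i → i < k → f i ≡ g i) → sumSinceCut f k ≡ sumSinceCut g k
  sumSinceCut-cong zero    eq = refl
  sumSinceCut-cong (suc k) eq with isCut (suc k)
  ... | true  = refl
  ... | false = cong₂ _+_ (sumSinceCut-cong k (λ i i<k → eq i (m<n⇒m<1+n i<k))) (eq k ≤-refl)

  sumUntilCut-cong : ∀ {f g} → (∀ i → i < m → f i ≡ g i) → ∀ k → sumUntilCut f k ≡ sumUntilCut g k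
  sumUntilCut-cong eq = foldDown-cong _ _ (λ i acc i<m → cong (_+ (if isCut (suc i) then 0 else acc)) (eq i i<m))

  flip-cong : ∀ {x y} k → k < m → (∀ i → i < m → x i ≡ y i) → flip x k ≡ flip y k
  flip-cong {x} {y} k k<m eq = cong (λ l → clamp (F (suc k)) (mirror (blockBottom k) (blockTop k) l) (H k)) level-eq
    where
      γ-eq : ∀ i → i < m → γ x i ≡ γ y i
      γ-eq i i<m = cong (_∸ H (suc i)) (eq i i<m)
      level-eq : level x k ≡ level y k
      level-eq = cong₂ _+_ (cong (blockBottom k +_) (sumSinceCut-cong k (λ i i<k → γ-eq i (<-trans i<k k<m))))
                           (sumUntilCut-cong γ-eq k)

  blockSum : (ℕ → ℕ) → ℕ → ℕ
  blockSum f k = if isCut (suc k) then sumSinceCut f k + f k else 0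

  sumTo-blockSum : ∀ f n → sumTo n f ≡ sumTo n (blockSum f) + sumSinceCut f n
  sumTo-blockSum f zero = refl
  sumTo-blockSum f (suc n) with isCut (suc n) in cut
  ... | true  rewrite sumTo-blockSum f n = trans (+-assoc (sumTo n (blockSum f)) (sumSinceCut f n) (f n)) (sym (+-identityʳ _))
  ... | false rewrite sumTo-blockSum f n | +-identityʳ (sumTo n (blockSum f)) =
    +-assoc (sumTo n (blockSum f)) (sumSinceCut f n) (f n)

  module WithBounds (F↓ : ∀ b → F (suc b) ≤ F b) (H↓ : ∀ b → H (suc b) ≤ H b)
                    (F≤H : ∀ b → b ≤ m → F b ≤ H b) (F0≡H0 : F 0 ≡ H 0) (Fm≡Hm : F m ≡ H m) where

    isCut-m : isCut m ≡ true
    isCut-m = Equivalence.to T-≡ (≡⇒≡ᵇ (F m) (H m) Fm≡Hm)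

    noCut⇒<m : ∀ {k} → k < m → isCut (suc k) ≡ false → suc k < m
    noCut⇒<m k<m ¬cut with m≤n⇒m<n∨m≡n k<m
    ... | inj₁ 1+k<m = 1+k<m
    ... | inj₂ refl  = contradiction (trans (sym ¬cut) isCut-m) λ ()

    noCut⇒F<H : ∀ {b} → b ≤ m → isCut b ≡ false → F b < H b
    noCut⇒F<H b≤m ¬cut = ≤∧≢⇒< (F≤H _ b≤m) (¬isCut⇒≢ ¬cut)

    F[1+k]≤H[k] : ∀ {k} → k < m → F (suc k) ≤ H k
    F[1+k]≤H[k] {k} k<m = ≤-trans (F↓ k) (F≤H k (<⇒≤ k<m))

    sumTo-blockSum-m : ∀ f → sumTo m f ≡ sumTo m (blockSum f)
    sumTo-blockSum-m f = trans (sumTo-blockSum f m) (trans (cong (sumTo m (blockSum f) +_) (noneSince m refl)) (+-identityʳ _))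
      where
        noneSince : ∀ n → n ≡ m → sumSinceCut f n ≡ 0
        noneSince zero    _   = refl
        noneSince (suc n) 1+n≡m = sumSinceCut-cut (subst (λ b → isCut b ≡ true) (sym 1+n≡m) isCut-m) f

    blockBottom≤F : ∀ k → k < m → blockBottom k ≤ F (suc k)
    blockBottom≤F = downward-induction (λ k → blockBottom k ≤ F (suc k)) step
      where
        step : ∀ k → k < m → (suc k < m → blockBottom (suc k) ≤ F (suc (suc k))) → blockBottom k ≤ F (suc k)
        step k k<m ih with isCut (suc k) in cut
        ... | true  = ≤-reflexive (blockBottom-cut cut k<m)
        ... | false rewrite blockBottom-noCut cut k<m = ≤-trans (ih (noCut⇒<m k<m cut)) (F↓ (suc k))

    blockBottom≤H : ∀ {k} → k < m → blockBottom k ≤ H k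
    blockBottom≤H {k} k<m = ≤-trans (blockBottom≤F k k<m) (F[1+k]≤H[k] k<m)

    module OnPath (x : ℕ → ℕ) (path : Path m F H x) where
      open Path path

      enter leave : ℕ → ℕ
      enter k = F k ⊔ x k
      leave k = x k ⊓ H (suc k)

      enter≡x+α : ∀ k → enter k ≡ x k + α x k
      enter≡x+α k = m⊔n≡n+[m∸n] (F k) (x k)

      x≡leave+γ : ∀ k → x k ≡ leave k + γ x k
      x≡leave+γ k = m≡m⊓n+[m∸n] (x k) (H (suc k))

      leave-cut : ∀ {k} → k < m → isCut (suc k) ≡ true → leave k ≡ F (suc k)
      leave-cut {k} k<m cut = trans (m≥n⇒m⊓n≡n (subst (_≤ x k) (isCut⇒≡ cut) (lower k k<m))) (sym (isCut⇒≡ cut))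

      enter-cut : ∀ {k} → k < m → isCut k ≡ true → enter k ≡ H k
      enter-cut {k} k<m cut = trans (m≥n⇒m⊔n≡m (subst (x k ≤_) (sym (isCut⇒≡ cut)) (upper k k<m))) (isCut⇒≡ cut)

      enter-0 : 0 < m → enter 0 ≡ H 0
      enter-0 0<m = trans (m≥n⇒m⊔n≡m (subst (x 0 ≤_) (sym F0≡H0) (upper 0 0<m))) F0≡H0

      enter-step : ∀ {k} → suc k < m → enter k ≡ enter (suc k) + γ x k + α x k
      enter-step {k} 1+k<m =
        trans (enter≡x+α k) (cong (_+ α x k) (trans (x≡leave+γ k) (cong (_+ γ x k) (sym (glue k 1+k<m)))))

      enter-step-cut : ∀ {k} → k < m → isCut (suc k) ≡ true → enter k ≡ F (suc k) + γ x k + α x k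
      enter-step-cut {k} k<m cut =
        trans (enter≡x+α k) (cong (_+ α x k) (trans (x≡leave+γ k) (cong (_+ γ x k) (leave-cut k<m cut))))

      blockTop≡enter+sums : ∀ k → k < m → blockTop k ≡ enter k + sumSinceCut (γ x) k + sumSinceCut (α x) k
      blockTop≡enter+sums zero    0<m = sym (trans (+-identityʳ _) (trans (+-identityʳ _) (enter-0 0<m)))
      blockTop≡enter+sums (suc k) 1+k<m with isCut (suc k) in cut
      ... | true  = sym (trans (+-identityʳ _) (trans (+-identityʳ _) (enter-cut 1+k<m cut)))
      ... | false = begin
        blockTop k ≡⟨ blockTop≡enter+sums k (<-trans (n<1+n k) 1+k<m) ⟩
        enter k + sumSinceCut (γ x) k + sumSinceCut (α x) k
          ≡⟨ cong (λ z → z + sumSinceCut (γ x) k + sumSinceCut (α x) k) (enter-step 1+k<m) ⟩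
        enter (suc k) + γ x k + α x k + sumSinceCut (γ x) k + sumSinceCut (α x) k
          ≡⟨ solve 5 (λ e g a d₁ d₂ → e :+ g :+ a :+ d₁ :+ d₂ := e :+ (d₁ :+ g) :+ (d₂ :+ a)) refl
                     (enter (suc k)) (γ x k) (α x k) (sumSinceCut (γ x) k) (sumSinceCut (α x) k) ⟩
        enter (suc k) + (sumSinceCut (γ x) k + γ x k) + (sumSinceCut (α x) k + α x k) ∎
        where open ≡-Reasoning

      enter≡blockBottom+sums : ∀ k → k < m → enter k ≡ blockBottom k + sumUntilCut (γ x) k + sumUntilCut (α x) k
      enter≡blockBottom+sums = downward-induction _ step
        where
          step : ∀ k → k < m → (suc k < m → enter (suc k) ≡ blockBottom (suc k) + sumUntilCut (γ x) (suc k) + sumUntilCut (α x) (suc k)) →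
                 enter k ≡ blockBottom k + sumUntilCut (γ x) k + sumUntilCut (α x) k
          step k k<m ih with isCut (suc k) in cut
          ... | true rewrite blockBottom-cut cut k<m | sumUntilCut-cut cut (γ x) k<m | sumUntilCut-cut cut (α x) k<m =
            enter-step-cut k<m cut
          ... | false rewrite blockBottom-noCut cut k<m | sumUntilCut-noCut cut (γ x) k<m | sumUntilCut-noCut cut (α x) k<m =
            trans (enter-step 1+k<m) (trans (cong (λ z → z + γ x k + α x k) (ih 1+k<m))
              (solve 5 (λ b u₁ u₂ g a → b :+ u₁ :+ u₂ :+ g :+ a := b :+ (g :+ u₁) :+ (a :+ u₂)) refl
                 (blockBottom (suc k)) (sumUntilCut (γ x) (suc k)) (sumUntilCut (α x) (suc k)) (γ x k) (α x k)))
            where 1+k<m = noCut⇒<m k<m cut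

      F<x-propagates : ∀ {k} → suc k < m → isCut (suc k) ≡ false → F (suc k) < x k → F (suc k) < x (suc k)
      F<x-propagates {k} 1+k<m ¬cut F<x =
        m<m⊔n⇒m<n (subst (F (suc k) <_) (sym (glue k 1+k<m)) (⊓-pres-m< F<x (noCut⇒F<H (<⇒≤ 1+k<m) ¬cut)))

      x<H-propagates : ∀ {k} → suc k < m → isCut (suc k) ≡ false → x (suc k) < H (suc k) → x k < H (suc k)
      x<H-propagates {k} 1+k<m ¬cut x<H =
        m⊓n<n⇒m<n (subst (_< H (suc k)) (glue k 1+k<m) (⊔-pres-<m (noCut⇒F<H (<⇒≤ 1+k<m) ¬cut) x<H))

      F<x⇒noDeficitUntilCut : ∀ j → j < m → F j < x j → sumUntilCut (α x) j ≡ 0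
      F<x⇒noDeficitUntilCut = downward-induction _ step
        where
          step : ∀ j → j < m → (suc j < m → F (suc j) < x (suc j) → sumUntilCut (α x) (suc j) ≡ 0) →
                 F j < x j → sumUntilCut (α x) j ≡ 0
          step j j<m ih F<x with isCut (suc j) in cut
          ... | true  = trans (sumUntilCut-cut cut (α x) j<m) (m≤n⇒m∸n≡0 (<⇒≤ F<x))
          ... | false = trans (sumUntilCut-noCut cut (α x) j<m)
                              (cong₂ _+_ (m≤n⇒m∸n≡0 (<⇒≤ F<x))
                                         (ih 1+j<m (F<x-propagates 1+j<m cut (≤-<-trans (F↓ j) F<x))))
            where 1+j<m = noCut⇒<m j<m cut

      x<H⇒noExcessSinceCut : ∀ k → k < m → x k < H k → sumSinceCut (γ x) k ≡ 0
      x<H⇒noExcessSinceCut zero    _     _   = refl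
      x<H⇒noExcessSinceCut (suc k) 1+k<m x<H with isCut (suc k) in cut
      ... | true  = refl
      ... | false = cong₂ _+_ (x<H⇒noExcessSinceCut k (<-trans (n<1+n k) 1+k<m) (<-≤-trans x[k]<H (H↓ k)))
                              (m≤n⇒m∸n≡0 (<⇒≤ x[k]<H))
        where x[k]<H = x<H-propagates 1+k<m cut x<H

      laterDeficit : ℕ → ℕ
      laterDeficit k = if isCut (suc k) then 0 else sumUntilCut (α x) (suc k)

      sumUntilCut-α : ∀ {k} → k < m → sumUntilCut (α x) k ≡ α x k + laterDeficit k
      sumUntilCut-α {k} k<m with isCut (suc k) in cut
      ... | true  = trans (sumUntilCut-cut cut (α x) k<m) (sym (+-identityʳ _))
      ... | false = sumUntilCut-noCut cut (α x) k<m

      level+laterDeficit : ∀ {k} → k < m → level x k + laterDeficit k ≡ x k + sumSinceCut (γ x) k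
      level+laterDeficit {k} k<m = +-cancelʳ-≡ (α x k) _ _ (begin
        level x k + laterDeficit k + α x k
          ≡⟨ solve 5 (λ b s u r a → b :+ s :+ u :+ r :+ a := b :+ u :+ (a :+ r) :+ s) refl
                     (blockBottom k) (sumSinceCut (γ x) k) (sumUntilCut (γ x) k) (laterDeficit k) (α x k) ⟩
        blockBottom k + sumUntilCut (γ x) k + (α x k + laterDeficit k) + sumSinceCut (γ x) k
          ≡⟨ cong (λ z → blockBottom k + sumUntilCut (γ x) k + z + sumSinceCut (γ x) k) (sym (sumUntilCut-α k<m)) ⟩
        enter′ + sumSinceCut (γ x) k
          ≡⟨ cong (_+ sumSinceCut (γ x) k) (trans (sym (enter≡blockBottom+sums k k<m)) (enter≡x+α k)) ⟩
        x k + α x k + sumSinceCut (γ x) k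
          ≡⟨ solve 3 (λ a b c → a :+ b :+ c := a :+ c :+ b) refl (x k) (α x k) (sumSinceCut (γ x) k) ⟩
        x k + sumSinceCut (γ x) k + α x k ∎)
        where
          open ≡-Reasoning
          enter′ = blockBottom k + sumUntilCut (γ x) k + sumUntilCut (α x) k

      x≡clamp-level : ∀ k → k < m → x k ≡ clamp (F (suc k)) (level x k) (H k)
      x≡clamp-level k k<m = clamp-unique (lower k k<m) (upper k k<m) above below
        where
          noLaterDeficit : F (suc k) < x k → laterDeficit k ≡ 0
          noLaterDeficit F<x with isCut (suc k) in cut
          ... | true  = refl
          ... | false = F<x⇒noDeficitUntilCut (suc k) 1+k<m (F<x-propagates 1+k<m cut F<x)
            where 1+k<m = noCut⇒<m k<m cut
          above : F (suc k) < x k → x k ≤ level x k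
          above F<x = ≤-trans (m≤m+n (x k) _)
            (≤-reflexive (trans (sym (level+laterDeficit k<m)) (trans (cong (level x k +_) (noLaterDeficit F<x)) (+-identityʳ _))))
          below : x k < H k → level x k ≤ x k
          below x<H = ≤-trans (m≤m+n (level x k) _)
            (≤-reflexive (trans (level+laterDeficit k<m) (trans (cong (x k +_) (x<H⇒noExcessSinceCut k k<m x<H)) (+-identityʳ _))))

      blockBottom≤level : ∀ k → blockBottom k ≤ level x k
      blockBottom≤level k = ≤-trans (m≤m+n (blockBottom k) _) (m≤m+n _ (sumUntilCut (γ x) k))

      blockTop≡level+deficits : ∀ k → k < m → blockTop k ≡ level x k + (sumUntilCut (α x) k + sumSinceCut (α x) k)
      blockTop≡level+deficits k k<m =
        trans (blockTop≡enter+sums k k<m)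
          (trans (cong (λ z → z + sumSinceCut (γ x) k + sumSinceCut (α x) k) (enter≡blockBottom+sums k k<m))
            (solve 5 (λ b u a d da → b :+ u :+ a :+ d :+ da := b :+ d :+ u :+ (a :+ da)) refl
               (blockBottom k) (sumUntilCut (γ x) k) (sumUntilCut (α x) k) (sumSinceCut (γ x) k) (sumSinceCut (α x) k)))

      level≤blockTop : ∀ k → k < m → level x k ≤ blockTop k
      level≤blockTop k k<m = ≤-trans (m≤m+n (level x k) _) (≤-reflexive (sym (blockTop≡level+deficits k k<m)))

      blockDeficit≡top∸level : ∀ {k} → k < m → isCut (suc k) ≡ true → sumSinceCut (α x) k + α x k ≡ blockTop k ∸ level x k
      blockDeficit≡top∸level {k} k<m cut = sym (begin
        blockTop k ∸ level x k
          ≡⟨ cong (_∸ level x k) (blockTop≡level+deficits k k<m) ⟩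
        level x k + (sumUntilCut (α x) k + sumSinceCut (α x) k) ∸ level x k
          ≡⟨ m+n∸m≡n (level x k) _ ⟩
        sumUntilCut (α x) k + sumSinceCut (α x) k
          ≡⟨ cong (_+ sumSinceCut (α x) k) (sumUntilCut-cut cut (α x) k<m) ⟩
        α x k + sumSinceCut (α x) k
          ≡⟨ +-comm (α x k) _ ⟩
        sumSinceCut (α x) k + α x k ∎)
        where open ≡-Reasoning

    blockExcess≡level∸bottom : ∀ z {k} → k < m → isCut (suc k) ≡ true → sumSinceCut (γ z) k + γ z k ≡ level z k ∸ blockBottom k
    blockExcess≡level∸bottom z {k} k<m cut = sym (begin
      blockBottom k + sumSinceCut (γ z) k + sumUntilCut (γ z) k ∸ blockBottom k
        ≡⟨ cong (_∸ blockBottom k) (+-assoc (blockBottom k) _ _) ⟩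
      blockBottom k + (sumSinceCut (γ z) k + sumUntilCut (γ z) k) ∸ blockBottom k
        ≡⟨ m+n∸m≡n (blockBottom k) _ ⟩
      sumSinceCut (γ z) k + sumUntilCut (γ z) k
        ≡⟨ cong (sumSinceCut (γ z) k +_) (sumUntilCut-cut cut (γ z) k<m) ⟩
      sumSinceCut (γ z) k + γ z k ∎)
      where open ≡-Reasoning

    module ClampedLevel (s : ℕ → ℕ) (bottom≤s : ∀ k → k < m → blockBottom k ≤ s k) (s≤top : ∀ k → k < m → s k ≤ blockTop k)
                        (s-noCut : ∀ {k} → suc k < m → isCut (suc k) ≡ false → s (suc k) ≡ s k) where

      y : ℕ → ℕ
      y k = clamp (F (suc k)) (s k) (H k)

      y-glue : ∀ k → suc k < m → F (suc k) ⊔ y (suc k) ≡ y k ⊓ H (suc k)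
      y-glue k 1+k<m with isCut (suc k) in cut
      ... | true = trans lhs (sym rhs)
        where
          k<m = <-trans (n<1+n k) 1+k<m
          F≡H = isCut⇒≡ cut
          lhs : F (suc k) ⊔ y (suc k) ≡ F (suc k)
          lhs = trans (m≥n⇒m⊔[n⊔o]≡m⊔o (F↓ (suc k))) (m≥n⇒m⊔n≡m (≤-trans (m⊓n≤n _ _) (≤-reflexive (sym F≡H))))
          F≤y : F (suc k) ≤ y k
          F≤y = ≤-trans (⊓-glb (subst (_≤ s k) (blockBottom-cut cut k<m) (bottom≤s k k<m)) (≤-trans (≤-reflexive F≡H) (H↓ k)))
                        (m≤n⊔m (F (suc k)) (s k ⊓ H k))
          rhs : y k ⊓ H (suc k) ≡ F (suc k)
          rhs = trans (m≥n⇒m⊓n≡n (≤-trans (≤-reflexive (sym F≡H)) F≤y)) (sym F≡H)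
      ... | false rewrite s-noCut 1+k<m cut =
        trans (m≥n⇒m⊔[n⊔o]≡m⊔o (F↓ (suc k))) (sym (clamp-⊓ (F≤H (suc k) (<⇒≤ 1+k<m)) (H↓ k)))

      y-path : Path m F H y
      y-path = record
        { lower = λ k k<m → lo≤clamp (F (suc k)) (s k) (H k)
        ; upper = λ k k<m → clamp≤hi (F (suc k)) (s k) (H k) (F[1+k]≤H[k] k<m)
        ; glue  = y-glue
        }

      γ-y : ∀ {k} → k < m → γ y k ≡ (s k ⊓ H k) ∸ H (suc k)
      γ-y {k} k<m = m≤o⇒[m⊔n]∸o≡n∸o (F≤H (suc k) k<m)

      sumUntilCut-γ-y : ∀ k → k < m → sumUntilCut (γ y) k ≡ (s k ⊓ H k) ∸ blockBottom k
      sumUntilCut-γ-y = downward-induction _ step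
        where
          step : ∀ k → k < m → (suc k < m → sumUntilCut (γ y) (suc k) ≡ (s (suc k) ⊓ H (suc k)) ∸ blockBottom (suc k)) →
                 sumUntilCut (γ y) k ≡ (s k ⊓ H k) ∸ blockBottom k
          step k k<m ih with isCut (suc k) in cut
          ... | true rewrite sumUntilCut-cut cut (γ y) k<m | blockBottom-cut cut k<m | γ-y k<m | isCut⇒≡ cut = refl
          ... | false rewrite sumUntilCut-noCut cut (γ y) k<m | γ-y k<m | ih (noCut⇒<m k<m cut)
                            | s-noCut (noCut⇒<m k<m cut) cut | sym (blockBottom-noCut cut k<m) =
            trans (cong (λ z → (s k ⊓ H k) ∸ H (suc k) + (z ∸ blockBottom k)) (o≤n⇒m⊓o≡[m⊓n]⊓o (H↓ k)))
                  (∸-telescope-⊓ (≤-trans (blockBottom≤F k k<m) (F≤H (suc k) k<m)) (⊓-glb (bottom≤s k k<m) (blockBottom≤H k<m)))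

      sumSinceCut-γ-y : ∀ k → k < m → sumSinceCut (γ y) k ≡ s k ∸ (s k ⊓ H k)
      sumSinceCut-γ-y zero 0<m rewrite m≤n⇒m⊓n≡m (s≤top 0 0<m) = sym (n∸n≡0 (s 0))
      sumSinceCut-γ-y (suc k) 1+k<m with isCut (suc k) in cut
      ... | true rewrite m≤n⇒m⊓n≡m (subst (s (suc k) ≤_) (blockTop-cut cut) (s≤top (suc k) 1+k<m)) = sym (n∸n≡0 (s (suc k)))
      ... | false rewrite sumSinceCut-γ-y k (<-trans (n<1+n k) 1+k<m) | γ-y (<-trans (n<1+n k) 1+k<m) | s-noCut 1+k<m cut =
        ∸-telescope-⊓⊓ (H↓ k)

      level-y : ∀ k → k < m → level y k ≡ s k
      level-y k k<m rewrite sumSinceCut-γ-y k k<m | sumUntilCut-γ-y k k<m =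
        m+[o∸n]+[n∸m]≡o (⊓-glb (bottom≤s k k<m) (blockBottom≤H k<m)) (m⊓n≤m (s k) (H k))

    module Flip (x : ℕ → ℕ) (path : Path m F H x) where
      open OnPath x path

      mirrored : ℕ → ℕ
      mirrored k = mirror (blockBottom k) (blockTop k) (level x k)

      mirrored-noCut : ∀ {k} → suc k < m → isCut (suc k) ≡ false → mirrored (suc k) ≡ mirrored k
      mirrored-noCut {k} 1+k<m ¬cut =
        trans (cong (λ b → mirror b (blockTop (suc k)) (level x (suc k))) (sym (blockBottom-noCut ¬cut k<m)))
              (cong₂ (mirror (blockBottom k)) (blockTop-noCut ¬cut) (level-noCut ¬cut x k<m))
        where k<m = <-trans (n<1+n k) 1+k<m

      open ClampedLevel mirrored (λ k k<m → lo≤mirror (level≤blockTop k k<m)) (λ k k<m → mirror≤hi (blockBottom≤level k)) mirrored-noCut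
        using () renaming (y-path to flip-path; level-y to level-flip) public
      private module OnFlip = OnPath (flip x) flip-path

      flip-involutive : ∀ k → k < m → flip (flip x) k ≡ x k
      flip-involutive k k<m = begin
        flip (flip x) k
          ≡⟨ cong (λ z → clamp (F (suc k)) (mirror (blockBottom k) (blockTop k) z) (H k)) (level-flip k k<m) ⟩
        clamp (F (suc k)) (mirror (blockBottom k) (blockTop k) (mirrored k)) (H k)
          ≡⟨ cong (λ z → clamp (F (suc k)) z (H k)) (mirror-involutive (level≤blockTop k k<m)) ⟩
        clamp (F (suc k)) (level x k) (H k)
          ≡⟨ sym (x≡clamp-level k k<m) ⟩
        x k ∎
        where open ≡-Reasoning

      sumTo-α-flip : sumTo m (α (flip x)) ≡ sumTo m (γ x)
      sumTo-α-flip = trans (sumTo-blockSum-m (α (flip x))) (trans (sumTo-cong m perBlock) (sym (sumTo-blockSum-m (γ x))))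
        where
          perBlock : ∀ k → k < m → blockSum (α (flip x)) k ≡ blockSum (γ x) k
          perBlock k k<m with isCut (suc k) in cut
          ... | false = refl
          ... | true  = begin
            sumSinceCut (α (flip x)) k + α (flip x) k ≡⟨ OnFlip.blockDeficit≡top∸level k<m cut ⟩
            blockTop k ∸ level (flip x) k ≡⟨ cong (blockTop k ∸_) (level-flip k k<m) ⟩
            blockTop k ∸ mirrored k ≡⟨ hi∸mirror (level≤blockTop k k<m) ⟩
            level x k ∸ blockBottom k ≡⟨ sym (blockExcess≡level∸bottom x k<m cut) ⟩
            sumSinceCut (γ x) k + γ x k ∎
            where open ≡-Reasoning

      sumTo-γ-flip : sumTo m (γ (flip x)) ≡ sumTo m (α x)
      sumTo-γ-flip = trans (sumTo-blockSum-m (γ (flip x))) (trans (sumTo-cong m perBlock) (sym (sumTo-blockSum-m (α x))))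
        where
          perBlock : ∀ k → k < m → blockSum (γ (flip x)) k ≡ blockSum (α x) k
          perBlock k k<m with isCut (suc k) in cut
          ... | false = refl
          ... | true  = begin
            sumSinceCut (γ (flip x)) k + γ (flip x) k ≡⟨ blockExcess≡level∸bottom (flip x) k<m cut ⟩
            level (flip x) k ∸ blockBottom k ≡⟨ cong (_∸ blockBottom k) (level-flip k k<m) ⟩
            mirrored k ∸ blockBottom k ≡⟨ mirror∸lo (blockBottom k) (blockTop k) (level x k) ⟩
            blockTop k ∸ level x k ≡⟨ sym (blockDeficit≡top∸level k<m cut) ⟩
            sumSinceCut (α x) k + α x k ∎
            where open ≡-Reasoning

record RawPath (m′ : ℕ) (A G x : ℕ → ℕ) : Set where
  field
    start : x 0 ≤ A 0
    end   : G m′ ≤ x m′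
    glue  : ∀ k → suc k < suc m′ → A (suc k) ⊔ x (suc k) ≡ x k ⊓ G k

module RawPathProperties {m′ : ℕ} {A G x : ℕ → ℕ} (raw : RawPath m′ A G x) where
  open RawPath raw

  x↓ : ∀ k → suc k < suc m′ → x (suc k) ≤ x k
  x↓ k 1+k<m = ≤-trans (m≤n⊔m (A (suc k)) (x (suc k))) (≤-trans (≤-reflexive (glue k 1+k<m)) (m⊓n≤m (x k) (G k)))

  A≤x : ∀ k → suc k < suc m′ → A (suc k) ≤ x k
  A≤x k 1+k<m = ≤-trans (m≤m⊔n (A (suc k)) (x (suc k))) (≤-trans (≤-reflexive (glue k 1+k<m)) (m⊓n≤m (x k) (G k)))

  x≤G : ∀ k → suc k < suc m′ → x (suc k) ≤ G k
  x≤G k 1+k<m = ≤-trans (m≤n⊔m (A (suc k)) (x (suc k))) (≤-trans (≤-reflexive (glue k 1+k<m)) (m⊓n≤n (x k) (G k)))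

module Closure (m′ : ℕ) (A G : ℕ → ℕ) where
  m : ℕ
  m = suc m′
  open Downward m

  maxFrom : ℕ → ℕ
  maxFrom = foldDown (λ i acc → A i ⊔ acc)

  F H : ℕ → ℕ
  F b = G m′ ⊔ maxFrom b
  H zero    = A 0
  H (suc b) = H b ⊓ G b

  maxFrom-step : ∀ {b} → b < m → maxFrom b ≡ A b ⊔ maxFrom (suc b)
  maxFrom-step = foldDown-step (λ i acc → A i ⊔ acc)

  maxFrom-beyond : ∀ {b} → m ≤ b → maxFrom b ≡ 0
  maxFrom-beyond m≤b rewrite m≤n⇒m∸n≡0 m≤b = refl

  F↓ : ∀ b → F (suc b) ≤ F b
  F↓ b with b <? m
  ... | yes b<m rewrite maxFrom-step b<m = ⊔-monoʳ-≤ (G m′) (m≤n⊔m (A b) (maxFrom (suc b)))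
  ... | no b≮m rewrite maxFrom-beyond (≮⇒≥ b≮m) | maxFrom-beyond (m≤n⇒m≤1+n (≮⇒≥ b≮m)) = ≤-refl

  H↓ : ∀ b → H (suc b) ≤ H b
  H↓ b = m⊓n≤m (H b) (G b)

  A≤F : ∀ {b} → b < m → A b ≤ F b
  A≤F {b} b<m rewrite maxFrom-step b<m = ≤-trans (m≤m⊔n (A b) (maxFrom (suc b))) (m≤n⊔m (G m′) _)

  F≤A⊔x : ∀ {b x} → b < m → G m′ ≤ x → maxFrom (suc b) ≤ x → F b ≤ A b ⊔ x
  F≤A⊔x {b} {x} b<m G≤x max≤x rewrite maxFrom-step b<m =
    ⊔-lub (≤-trans G≤x (m≤n⊔m (A b) x)) (⊔-lub (m≤m⊔n (A b) x) (≤-trans max≤x (m≤n⊔m (A b) x)))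

  module FromRaw (x : ℕ → ℕ) (raw : RawPath m′ A G x) where
    open RawPath raw
    open RawPathProperties raw

    G≤x : ∀ k → k < m → G m′ ≤ x k
    G≤x k k<m = ≤-trans end (antitone-≤ x m x↓ (≤-pred k<m) ≤-refl)

    maxFrom≤x : ∀ k → k < m → maxFrom (suc k) ≤ x k
    maxFrom≤x = downward-induction (λ k → maxFrom (suc k) ≤ x k) step
      where
        step : ∀ k → k < m → (suc k < m → maxFrom (suc (suc k)) ≤ x (suc k)) → maxFrom (suc k) ≤ x k
        step k k<m ih with suc k <? m
        ... | yes 1+k<m rewrite maxFrom-step 1+k<m = ⊔-lub (A≤x k 1+k<m) (≤-trans (ih 1+k<m) (x↓ k 1+k<m))
        ... | no 1+k≮m rewrite maxFrom-beyond (≮⇒≥ 1+k≮m) = z≤n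

    x≤H : ∀ k → k < m → x k ≤ H k
    x≤H zero    _     = start
    x≤H (suc k) 1+k<m = ⊓-glb (≤-trans (x↓ k 1+k<m) (x≤H k (<-trans (n<1+n k) 1+k<m)))
                              (x≤G k 1+k<m)

    path : Path m F H x
    path = record
      { lower = λ k k<m → ⊔-lub (G≤x k k<m) (maxFrom≤x k k<m)
      ; upper = x≤H
      ; glue  = λ k 1+k<m → begin
          F (suc k) ⊔ x (suc k) ≡⟨ ≤-antisym (⊔-lub (F≤A⊔x 1+k<m (G≤x (suc k) 1+k<m) (maxFrom≤x (suc k) 1+k<m)) (m≤n⊔m _ _))
                                             (⊔-monoˡ-≤ (x (suc k)) (A≤F 1+k<m)) ⟩
          A (suc k) ⊔ x (suc k) ≡⟨ glue k 1+k<m ⟩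
          x k ⊓ G k             ≡⟨ sym (trans (sym (⊓-assoc (x k) (H k) (G k))) (cong (_⊓ G k) (m≤n⇒m⊓n≡m (x≤H k (<-trans (n<1+n k) 1+k<m))))) ⟩
          x k ⊓ H (suc k)       ∎
      }
      where open ≡-Reasoning

    A⊔x≤H : ∀ b → b < m → A b ⊔ x b ≤ H b
    A⊔x≤H zero    _ = ⊔-lub ≤-refl start
    A⊔x≤H (suc b) 1+b<m rewrite glue b 1+b<m =
      ⊓-glb (≤-trans (m⊓n≤m (x b) (G b)) (x≤H b (<-trans (n<1+n b) 1+b<m))) (m⊓n≤n (x b) (G b))

    F≤H : ∀ b → b ≤ m → F b ≤ H b
    F≤H b b≤m with m≤n⇒m<n∨m≡n b≤m
    ... | inj₁ b<m  = ≤-trans (F≤A⊔x b<m (G≤x b b<m) (maxFrom≤x b b<m)) (A⊔x≤H b b<m)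
    ... | inj₂ refl rewrite maxFrom-beyond {m} ≤-refl | ⊔-identityʳ (G m′) =
      ⊓-glb (≤-trans (G≤x m′ ≤-refl) (x≤H m′ ≤-refl)) ≤-refl

    F0≡H0 : F 0 ≡ H 0
    F0≡H0 = ≤-antisym (F≤H 0 z≤n) (A≤F (s≤s z≤n))

    Fm≡Hm : F m ≡ H m
    Fm≡Hm = ≤-antisym (F≤H m ≤-refl) (≤-trans (m⊓n≤n (H m′) (G m′)) (m≤m⊔n (G m′) _))

  module FromPath (F0≡H0 : F 0 ≡ H 0) (x : ℕ → ℕ) (path : Path m F H x) where
    open Path path

    F⊔x≡A⊔x : ∀ k → k < m → F k ⊔ x k ≡ A k ⊔ x k
    F⊔x≡A⊔x zero    _     = cong (_⊔ x 0) F0≡H0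
    F⊔x≡A⊔x (suc k) 1+k<m = ≤-antisym (⊔-lub F≤ (m≤n⊔m (A (suc k)) (x (suc k)))) (⊔-monoˡ-≤ (x (suc k)) (A≤F 1+k<m))
      where
        F[2+k]≤x : F (suc (suc k)) ≤ x (suc k)
        F[2+k]≤x = lower (suc k) 1+k<m
        F≤ : F (suc k) ≤ A (suc k) ⊔ x (suc k)
        F≤ = F≤A⊔x 1+k<m (≤-trans (m≤m⊔n (G m′) _) F[2+k]≤x) (≤-trans (m≤n⊔m (G m′) _) F[2+k]≤x)

    x⊓H≡x⊓G : ∀ k → k < m → x k ⊓ H (suc k) ≡ x k ⊓ G k
    x⊓H≡x⊓G k k<m = trans (sym (⊓-assoc (x k) (H k) (G k))) (cong (_⊓ G k) (m≤n⇒m⊓n≡m (upper k k<m)))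

    raw : RawPath m′ A G x
    raw = record
      { start = upper 0 (s≤s z≤n)
      ; end   = ≤-trans (m≤m⊔n (G m′) (maxFrom m)) (lower m′ ≤-refl)
      ; glue  = λ k 1+k<m → trans (sym (F⊔x≡A⊔x (suc k) 1+k<m)) (trans (glue k 1+k<m) (x⊓H≡x⊓G k (<-trans (n<1+n k) 1+k<m)))
      }

    F∸x≡A∸x : ∀ k → k < m → F k ∸ x k ≡ A k ∸ x k
    F∸x≡A∸x k k<m = trans (m∸n≡[m⊔n]∸n (F k) (x k)) (trans (cong (_∸ x k) (F⊔x≡A⊔x k k<m)) (sym (m∸n≡[m⊔n]∸n (A k) (x k))))

    x∸H≡x∸G : ∀ k → k < m → x k ∸ H (suc k) ≡ x k ∸ G k
    x∸H≡x∸G k k<m = trans (m∸n≡m∸[m⊓n] (x k) (H (suc k))) (trans (cong (x k ∸_) (x⊓H≡x⊓G k k<m)) (sym (m∸n≡m∸[m⊓n] (x k) (G k))))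

module RawPathFlip (m′ : ℕ) (A G : ℕ → ℕ) where
  open Closure m′ A G
  open Reflection m F H using (flip; flip-cong; α; γ; module WithBounds) public

  module _ (x : ℕ → ℕ) (raw : RawPath m′ A G x) where
    private
      module X = FromRaw x raw
      open WithBounds F↓ H↓ X.F≤H X.F0≡H0 X.Fm≡Hm
      open Flip x X.path
      module Y = FromPath X.F0≡H0 (flip x) flip-path
      module X′ = FromPath X.F0≡H0 x X.path

    flip-raw : RawPath m′ A G (flip x)
    flip-raw = Y.raw

    flip-flip : ∀ k → k < m → flip (flip x) k ≡ x k
    flip-flip = flip-involutive

    sumTo-deficit-flip : sumTo m (λ k → A k ∸ flip x k) ≡ sumTo m (λ k → x k ∸ G k)
    sumTo-deficit-flip = begin
      sumTo m (λ k → A k ∸ flip x k) ≡⟨ sumTo-cong m (λ k k<m → sym (Y.F∸x≡A∸x k k<m)) ⟩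
      sumTo m (α (flip x))           ≡⟨ sumTo-α-flip ⟩
      sumTo m (γ x)                  ≡⟨ sumTo-cong m X′.x∸H≡x∸G ⟩
      sumTo m (λ k → x k ∸ G k)      ∎
      where open ≡-Reasoning

    sumTo-excess-flip : sumTo m (λ k → flip x k ∸ G k) ≡ sumTo m (λ k → A k ∸ x k)
    sumTo-excess-flip = begin
      sumTo m (λ k → flip x k ∸ G k) ≡⟨ sumTo-cong m (λ k k<m → sym (Y.x∸H≡x∸G k k<m)) ⟩
      sumTo m (γ (flip x))           ≡⟨ sumTo-γ-flip ⟩
      sumTo m (α x)                  ≡⟨ sumTo-cong m X′.F∸x≡A∸x ⟩
      sumTo m (λ k → A k ∸ x k)      ∎
      where open ≡-Reasoning

-- Rows with entries in {1,2}

bit : Bool → ℕ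
bit true  = 1
bit false = 0

cell : ℕ → ℕ → ℕ → S12
cell q p j = if j <ᵇ q then s1 else if j <ᵇ p then s12 else s2

row : ℕ → Bool → ℕ → List S12
row a b c = replicate a s1 ++ replicate (bit b) s12 ++ replicate c s2

ones : List S12 → ℕ
ones []        = 0
ones (s1 ∷ r)  = suc (ones r)
ones (s2 ∷ r)  = 0
ones (s12 ∷ r) = 0

pair : List S12 → Bool
pair []        = false
pair (s1 ∷ r)  = pair r
pair (s2 ∷ r)  = false
pair (s12 ∷ r) = true

twos : List S12 → ℕ
twos []        = 0
twos (s1 ∷ r)  = twos r
twos (s2 ∷ r)  = suc (length r)
twos (s12 ∷ r) = length r

SortedRow : List S12 → Set
SortedRow r = ∀ t a b → nth r t ≡ just a → nth r (suc t) ≡ just b → a ≤S b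

SortedRow-tail : ∀ {a r} → SortedRow (a ∷ r) → SortedRow r
SortedRow-tail sorted t = sorted (suc t)

only-s2-after-2 : ∀ {a b} → maxS a ≡ 2 → a ≤S b → b ≡ s2
only-s2-after-2 {s1} () _
only-s2-after-2 {s2}  {s1}  _ (s≤s ())
only-s2-after-2 {s2}  {s2}  _ _ = refl
only-s2-after-2 {s2}  {s12} _ (s≤s ())
only-s2-after-2 {s12} {s1}  _ (s≤s ())
only-s2-after-2 {s12} {s2}  _ _ = refl
only-s2-after-2 {s12} {s12} _ (s≤s ())

all-s2 : ∀ {a} r → maxS a ≡ 2 → SortedRow (a ∷ r) → r ≡ replicate (length r) s2
all-s2 []      _   _      = refl
all-s2 (b ∷ r) max sorted with only-s2-after-2 max (sorted 0 _ b refl refl)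
... | refl = cong (s2 ∷_) (all-s2 r refl (SortedRow-tail sorted))

row-of-sorted : ∀ r → SortedRow r → row (ones r) (pair r) (twos r) ≡ r
row-of-sorted []        _      = refl
row-of-sorted (s1 ∷ r)  sorted = cong (s1 ∷_) (row-of-sorted r (SortedRow-tail sorted))
row-of-sorted (s2 ∷ r)  sorted = cong (s2 ∷_) (sym (all-s2 r refl sorted))
row-of-sorted (s12 ∷ r) sorted = cong (s12 ∷_) (sym (all-s2 r refl sorted))

row-parse : ∀ a b c → ones (row a b c) ≡ a × pair (row a b c) ≡ b × twos (row a b c) ≡ c
row-parse (suc a) b c with row-parse a b c
... | eq₁ , eq₂ , eq₃ = cong suc eq₁ , eq₂ , eq₃
row-parse zero true  c       = refl , refl , length-replicate c
row-parse zero false zero    = refl , refl , refl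
row-parse zero false (suc c) = refl , refl , cong suc (length-replicate c)

length-row : ∀ a b c → length (row a b c) ≡ a + bit b + c
length-row (suc a) b     c = cong suc (length-row a b c)
length-row zero    true  c = cong suc (length-replicate c)
length-row zero    false c = length-replicate c

excess : List S12 → ℕ
excess r = sum (map (λ A → card A ∸ 1) r)

excess-replicate-s2 : ∀ c → excess (replicate c s2) ≡ 0
excess-replicate-s2 zero    = refl
excess-replicate-s2 (suc c) = excess-replicate-s2 c

excess-row : ∀ a b c → excess (row a b c) ≡ bit b
excess-row (suc a) b     c = excess-row a b c
excess-row zero    true  c = cong suc (excess-replicate-s2 c)
excess-row zero    false c = excess-replicate-s2 c

nth-replicate : ∀ {A : Set} (a : A) c t → nth (replicate c a) t ≡ (if t <ᵇ c then just a else nothing)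
nth-replicate a zero    t       = refl
nth-replicate a (suc c) zero    = refl
nth-replicate a (suc c) (suc t) = nth-replicate a c t

nth-row : ∀ a b c t → nth (row a b c) t ≡ (if t <ᵇ a + bit b + c then just (cell a (a + bit b) t) else nothing)
nth-row (suc a) b     c zero    = refl
nth-row (suc a) b     c (suc t) = nth-row a b c t
nth-row zero    true  c zero    = refl
nth-row zero    true  c (suc t) = nth-replicate s2 c t
nth-row zero    false c zero    = nth-replicate s2 c zero
nth-row zero    false c (suc t) = nth-replicate s2 c (suc t)

[m∸o]<ᵇ[n∸o]≡m<ᵇn : ∀ {m n o} → o ≤ m → ((m ∸ o) <ᵇ (n ∸ o)) ≡ (m <ᵇ n)
[m∸o]<ᵇ[n∸o]≡m<ᵇn {m} {n} {o} o≤m with m <? n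
... | yes m<n = trans (<ᵇ-true (∸-monoˡ-< m<n o≤m)) (sym (<ᵇ-true m<n))
... | no m≮n  = trans (<ᵇ-false (∸-monoˡ-≤ o (≮⇒≥ m≮n))) (sym (<ᵇ-false (≮⇒≥ m≮n)))

boxEntry : ℕ → ℕ → ℕ → ℕ → ℕ → Maybe S12
boxEntry M L q p j = if j <ᵇ M then nothing else if j <ᵇ L then just (cell q p j) else nothing

-- The row occupying the columns [M, L) whose first box containing 2 is in column q.
shiftedRow : ℕ → ℕ → ℕ → Bool → List S12
shiftedRow M L q b = row (q ∸ M) b (L ∸ (q + bit b))

module _ {M L q : ℕ} (b : Bool) (M≤q : M ≤ q) (p≤L : q + bit b ≤ L) where

  length-shiftedRow : length (shiftedRow M L q b) ≡ L ∸ M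
  length-shiftedRow = begin
    length (shiftedRow M L q b)             ≡⟨ length-row (q ∸ M) b (L ∸ (q + bit b)) ⟩
    q ∸ M + bit b + (L ∸ (q + bit b))       ≡⟨ cong (_+ (L ∸ (q + bit b))) (sym (+-∸-comm (bit b) M≤q)) ⟩
    q + bit b ∸ M + (L ∸ (q + bit b))       ≡⟨ +-comm (q + bit b ∸ M) _ ⟩
    L ∸ (q + bit b) + (q + bit b ∸ M)       ≡⟨ ∸-telescope (≤-trans M≤q (m≤m+n q (bit b))) p≤L ⟩
    L ∸ M                                   ∎
    where open ≡-Reasoning

  nth-shiftedRow : ∀ {j} → M ≤ j → nth (shiftedRow M L q b) (j ∸ M) ≡ (if j <ᵇ L then just (cell q (q + bit b) j) else nothing)
  nth-shiftedRow {j} M≤j =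
    trans (nth-row (q ∸ M) b (L ∸ (q + bit b)) (j ∸ M)) (cong₂ (λ c v → if c then just v else nothing) inside same-cell)
    where
      inside : ((j ∸ M) <ᵇ (q ∸ M + bit b + (L ∸ (q + bit b)))) ≡ (j <ᵇ L)
      inside = trans (cong ((j ∸ M) <ᵇ_) (trans (sym (length-row (q ∸ M) b _)) length-shiftedRow))
                     ([m∸o]<ᵇ[n∸o]≡m<ᵇn M≤j)
      same-cell : cell (q ∸ M) (q ∸ M + bit b) (j ∸ M) ≡ cell q (q + bit b) j
      same-cell = cong₂ (λ c d → if c then s1 else if d then s12 else s2) ([m∸o]<ᵇ[n∸o]≡m<ᵇn M≤j)
        (trans (cong ((j ∸ M) <ᵇ_) (sym (+-∸-comm (bit b) M≤q))) ([m∸o]<ᵇ[n∸o]≡m<ᵇn M≤j))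

lookupOr : {A : Set} → A → List A → ℕ → A
lookupOr d []       i       = d
lookupOr d (x ∷ xs) zero    = x
lookupOr d (x ∷ xs) (suc i) = lookupOr d xs i

lookupOr-applyUpTo : ∀ {A : Set} (d : A) f {n i} → i < n → lookupOr d (applyUpTo f n) i ≡ f i
lookupOr-applyUpTo d f {suc n} {zero}  _   = refl
lookupOr-applyUpTo d f {suc n} {suc i} i<n = lookupOr-applyUpTo d (λ i → f (suc i)) (≤-pred i<n)

applyUpTo-cong : ∀ {A : Set} n {f g : ℕ → A} → (∀ i → i < n → f i ≡ g i) → applyUpTo f n ≡ applyUpTo g n
applyUpTo-cong zero    eq = refl
applyUpTo-cong (suc n) eq = cong₂ _∷_ (eq 0 (s≤s z≤n)) (applyUpTo-cong n (λ i i<n → eq (suc i) (s≤s i<n)))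

nth-applyUpTo : ∀ {A : Set} (f : ℕ → A) {n i} → i < n → nth (applyUpTo f n) i ≡ just (f i)
nth-applyUpTo f {suc n} {zero}  _   = refl
nth-applyUpTo f {suc n} {suc i} i<n = nth-applyUpTo (λ i → f (suc i)) (≤-pred i<n)

nth-applyUpTo-beyond : ∀ {A : Set} (f : ℕ → A) {n i} → n ≤ i → nth (applyUpTo f n) i ≡ nothing
nth-applyUpTo-beyond f {zero}          _         = refl
nth-applyUpTo-beyond f {suc n} {suc i} (s≤s n≤i) = nth-applyUpTo-beyond (λ i → f (suc i)) n≤i

part-beyond : ∀ xs {i} → length xs ≤ i → part xs i ≡ 0
part-beyond []                _         = refl
part-beyond (x ∷ xs) {suc i} (s≤s n≤i) = part-beyond xs n≤i

part-antitone : ∀ xs → Linked _≥_ xs → ∀ i → part xs (suc i) ≤ part xs i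
part-antitone []           _          i       = z≤n
part-antitone (x ∷ [])     _          zero    = z≤n
part-antitone (x ∷ [])     _          (suc i) = z≤n
part-antitone (x ∷ y ∷ xs) (x≥y ∷ _)  zero    = x≥y
part-antitone (x ∷ y ∷ xs) (_ ∷ rest) (suc i) = part-antitone (y ∷ xs) rest i

rowAt-∷ : ∀ r T i → rowAt (r ∷ T) (suc i) ≡ rowAt T i
rowAt-∷ r T i with nth T i
... | nothing = refl
... | just _  = refl

rowAt-nth : ∀ {T i r} → nth T i ≡ just r → rowAt T i ≡ r
rowAt-nth {T} {i} eq with nth T i
rowAt-nth refl | just r = refl

rowAt-beyond : ∀ {T i} → nth T i ≡ nothing → rowAt T i ≡ []
rowAt-beyond {T} {i} eq with nth T i
rowAt-beyond refl | nothing = refl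

nth-rowAt : ∀ (T : Filling) {i} → i < length T → nth T i ≡ just (rowAt T i)
nth-rowAt (r ∷ T) {zero}  _   = refl
nth-rowAt (r ∷ T) {suc i} i<n = trans (nth-rowAt T (≤-pred i<n)) (cong just (sym (rowAt-∷ r T i)))

applyUpTo-rowAt : ∀ (T : Filling) → T ≡ applyUpTo (rowAt T) (length T)
applyUpTo-rowAt []      = refl
applyUpTo-rowAt (r ∷ T) = cong (r ∷_) (trans (applyUpTo-rowAt T) (applyUpTo-cong (length T) (λ i _ → sym (rowAt-∷ r T i))))

entry-nth : ∀ mu {T i r} j → nth T i ≡ just r → entry mu T i j ≡ (if j <ᵇ part mu i then nothing else nth r (j ∸ part mu i))
entry-nth mu {T} {i} j eq with nth T i
entry-nth mu j refl | just r = refl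

entry-beyond : ∀ mu {T i} j → nth T i ≡ nothing → entry mu T i j ≡ nothing
entry-beyond mu {T} {i} j eq with nth T i
entry-beyond mu j refl | nothing = refl

module _ {q p j : ℕ} where

  cell-1 : j < q → cell q p j ≡ s1
  cell-1 j<q rewrite <ᵇ-true j<q = refl

  cell-12 : q ≤ j → j < p → cell q p j ≡ s12
  cell-12 q≤j j<p rewrite <ᵇ-false q≤j | <ᵇ-true j<p = refl

  cell-2 : q ≤ j → p ≤ j → cell q p j ≡ s2
  cell-2 q≤j p≤j rewrite <ᵇ-false q≤j | <ᵇ-false p≤j = refl

module _ {M L q p j : ℕ} where

  boxEntry-below : j < M → boxEntry M L q p j ≡ nothing
  boxEntry-below j<M rewrite <ᵇ-true j<M = refl

  boxEntry-above : L ≤ j → boxEntry M L q p j ≡ nothing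
  boxEntry-above L≤j rewrite <ᵇ-false L≤j with j <ᵇ M
  ... | true  = refl
  ... | false = refl

  boxEntry-inside : M ≤ j → j < L → boxEntry M L q p j ≡ just (cell q p j)
  boxEntry-inside M≤j j<L rewrite <ᵇ-false M≤j | <ᵇ-true j<L = refl

  boxEntry-just : ∀ {a} → boxEntry M L q p j ≡ just a → M ≤ j × j < L × a ≡ cell q p j
  boxEntry-just eq with j <? M | j <? L
  ... | yes j<M | _      = contradiction (trans (sym (boxEntry-below j<M)) eq) λ ()
  ... | no j≮M  | no j≮L = contradiction (trans (sym (boxEntry-above (≮⇒≥ j≮L))) eq) λ ()
  ... | no j≮M  | yes j<L with trans (sym (boxEntry-inside (≮⇒≥ j≮M) j<L)) eq
  ...   | refl = ≮⇒≥ j≮M , j<L , refl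

1≤minS : ∀ a → 1 ≤ minS a
1≤minS s1  = s≤s z≤n
1≤minS s2  = s≤s z≤n
1≤minS s12 = s≤s z≤n

maxS≤2 : ∀ a → maxS a ≤ 2
maxS≤2 s1  = s≤s z≤n
maxS≤2 s2  = ≤-refl
maxS≤2 s12 = ≤-refl

q+bit≤1+j : ∀ {q j} b → q ≤ j → j < q + bit b → q + bit b ≤ suc j
q+bit≤1+j {q} true  q≤j _   = ≤-trans (≤-reflexive (+-comm q 1)) (s≤s q≤j)
q+bit≤1+j {q} false q≤j j<q = contradiction (≤-trans j<q (≤-reflexive (+-identityʳ q))) (≤⇒≯ q≤j)

cell-rowSorted : ∀ q b j → cell q (q + bit b) j ≤S cell q (q + bit b) (suc j)
cell-rowSorted q b j with j <? q
... | yes j<q rewrite cell-1 {q} {q + bit b} j<q = 1≤minS _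
... | no j≮q with j <? q + bit b
...   | yes j<p rewrite cell-12 {q} {q + bit b} (≮⇒≥ j≮q) j<p
                      | cell-2 {q} {q + bit b} (m≤n⇒m≤1+n (≮⇒≥ j≮q)) (q+bit≤1+j b (≮⇒≥ j≮q) j<p) = ≤-refl
...   | no j≮p rewrite cell-2 {q} {q + bit b} (≮⇒≥ j≮q) (≮⇒≥ j≮p)
                     | cell-2 {q} {q + bit b} (m≤n⇒m≤1+n (≮⇒≥ j≮q)) (m≤n⇒m≤1+n (≮⇒≥ j≮p)) = ≤-refl

cell-columnSorted : ∀ q p q′ p′ j → q′ ≤ p′ → p′ ≤ q → cell q p j ≤S cell q′ p′ j
cell-columnSorted q p q′ p′ j q′≤p′ p′≤q with j <? q
... | yes j<q rewrite cell-1 {q} {p} j<q = 1≤minS _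
... | no j≮q rewrite cell-2 {q′} {p′} {j} (≤-trans q′≤p′ (≤-trans p′≤q (≮⇒≥ j≮q))) (≤-trans p′≤q (≮⇒≥ j≮q)) = maxS≤2 _

maxS-cell≡2 : ∀ q p {j} → q ≤ j → maxS (cell q p j) ≡ 2
maxS-cell≡2 q p {j} q≤j with j <? p
... | yes j<p rewrite cell-12 {q} {p} q≤j j<p = refl
... | no j≮p  rewrite cell-2 {q} {p} q≤j (≮⇒≥ j≮p) = refl

minS-cell≡1 : ∀ q p {j} → j < p → minS (cell q p j) ≡ 1
minS-cell≡1 q p {j} j<p with j <? q
... | yes j<q rewrite cell-1 {q} {p} j<q = refl
... | no j≮q  rewrite cell-12 {q} {p} (≮⇒≥ j≮q) j<p = refl

maxS-cell≡1 : ∀ q p {j} → j < q → maxS (cell q p j) ≡ 1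
maxS-cell≡1 q p j<q rewrite cell-1 {q} {p} j<q = refl

minS-cell≡2 : ∀ q p {j} → q ≤ p → p ≤ j → minS (cell q p j) ≡ 2
minS-cell≡2 q p q≤p p≤j rewrite cell-2 {q} {p} (≤-trans q≤p p≤j) p≤j = refl

-- Canonical fillings

firstTwo : List ℕ → Filling → ℕ → ℕ
firstTwo mu T i = part mu i + ones (rowAt T i)

hasPair : Filling → ℕ → Bool
hasPair T i = pair (rowAt T i)

module Canonical (la mu : List ℕ) where
  m : ℕ
  m = length la
  L M : ℕ → ℕ
  L = part la
  M = part mu

  filling : (ℕ → ℕ) → (ℕ → Bool) → Filling
  filling q b = applyUpTo (λ i → shiftedRow (M i) (L i) (q i) (b i)) m

  Fits : (ℕ → ℕ) → (ℕ → Bool) → Set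
  Fits q b = ∀ i → i < m → M i ≤ q i × q i + bit (b i) ≤ L i

  ColumnStrict : (ℕ → ℕ) → (ℕ → Bool) → Set
  ColumnStrict q b = ∀ i → suc i < m → q (suc i) + bit (b (suc i)) ≤ q i

  W : ℕ
  W = width la

  L-beyond : ∀ {i} → m ≤ i → L i ≡ 0
  L-beyond = part-beyond la

  -- Row i holds the top box of the columns [M i, topsEnd i) and the bottom box of [bottomsStart i, L i).
  topsEnd bottomsStart : ℕ → ℕ
  topsEnd i = prev W M i ⊓ L i
  bottomsStart i = L (suc i) ⊔ M i

  -- The columns j with T(i,j) = {1} and T(i+1,j) = {2}: the columns shared by rows i and i + 1
  -- that ceq does not count.
  strictPairs : (ℕ → ℕ) → (ℕ → Bool) → ℕ → ℕ
  strictPairs q b i = (q i ⊓ L (suc i)) ∸ (M i ⊔ (q (suc i) + bit (b (suc i))))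

  strictPairs-beyond : ∀ q b {k} → m ≤ suc k → strictPairs q b k ≡ 0
  strictPairs-beyond q b {k} m≤1+k rewrite L-beyond m≤1+k | ⊓-zeroʳ (q k) = 0∸n≡0 (M k ⊔ (q (suc k) + bit (b (suc k))))

  strictPairs-cong : ∀ {q q̃} b → (∀ i → i < m → q i ≡ q̃ i) → ∀ k → strictPairs q b k ≡ strictPairs q̃ b k
  strictPairs-cong {q} {q̃} b eq k with suc k <? m
  ... | yes 1+k<m = cong₂ (λ x y → (x ⊓ L (suc k)) ∸ (M k ⊔ (y + bit (b (suc k))))) (eq k (<-trans (n<1+n k) 1+k<m)) (eq (suc k) 1+k<m)
  ... | no 1+k≮m  = trans (strictPairs-beyond q b (≮⇒≥ 1+k≮m)) (sym (strictPairs-beyond q̃ b (≮⇒≥ 1+k≮m)))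

  filling-cong : ∀ {q q̃} b → (∀ i → i < m → q i ≡ q̃ i) → filling q b ≡ filling q̃ b
  filling-cong b eq = applyUpTo-cong m (λ i i<m → cong (λ z → shiftedRow (M i) (L i) z (b i)) (eq i i<m))

  rowAt-filling : ∀ q b {i} → i < m → rowAt (filling q b) i ≡ shiftedRow (M i) (L i) (q i) (b i)
  rowAt-filling q b {i} i<m = rowAt-nth {filling q b} {i} (nth-applyUpTo _ i<m)

  firstTwo-filling : ∀ {q b} → Fits q b → ∀ {i} → i < m → firstTwo mu (filling q b) i ≡ q i
  firstTwo-filling {q} {b} fits {i} i<m = begin
    M i + ones (rowAt (filling q b) i)  ≡⟨ cong (λ r → M i + ones r) (rowAt-filling q b i<m) ⟩
    M i + ones (shiftedRow (M i) (L i) (q i) (b i)) ≡⟨ cong (M i +_) (proj₁ (row-parse (q i ∸ M i) (b i) (L i ∸ (q i + bit (b i))))) ⟩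
    M i + (q i ∸ M i)                   ≡⟨ m+[n∸m]≡n (proj₁ (fits i i<m)) ⟩
    q i                                 ∎
    where open ≡-Reasoning

  hasPair-filling : ∀ q b {i} → i < m → hasPair (filling q b) i ≡ b i
  hasPair-filling q b {i} i<m =
    trans (cong pair (rowAt-filling q b i<m)) (proj₁ (proj₂ (row-parse (q i ∸ M i) (b i) (L i ∸ (q i + bit (b i))))))

  entry-filling : ∀ {q b} → Fits q b → ∀ i j → entry mu (filling q b) i j ≡ boxEntry (M i) (L i) (q i) (q i + bit (b i)) j
  entry-filling {q} {b} fits i j with i <? m
  ... | yes i<m = trans (entry-nth mu {filling q b} {i} j (nth-applyUpTo _ i<m)) inside
    where
      inside : (if j <ᵇ M i then nothing else nth (shiftedRow (M i) (L i) (q i) (b i)) (j ∸ M i)) ≡ boxEntry (M i) (L i) (q i) (q i + bit (b i)) j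
      inside with j <ᵇ M i in j<ᵇM
      ... | true  = refl
      ... | false = nth-shiftedRow (b i) (proj₁ (fits i i<m)) (proj₂ (fits i i<m)) (≮⇒≥ (λ j<M → subst T j<ᵇM (<⇒<ᵇ j<M)))
  ... | no i≮m = trans (entry-beyond mu {filling q b} {i} j (nth-applyUpTo-beyond _ (≮⇒≥ i≮m)))
                       (sym (boxEntry-above {M i} {L i} {q i} {q i + bit (b i)} (≤-trans (≤-reflexive (L-beyond (≮⇒≥ i≮m))) z≤n)))

  filling-valid : ∀ {q b} → Fits q b → ColumnStrict q b → IsSVRPP12 la mu (filling q b)
  filling-valid {q} {b} fits strict = length-applyUpTo _ m , rowLengths , rowsSorted , columnsSorted
    where
      rowLengths : ∀ i → i < m → length (rowAt (filling q b) i) ≡ L i ∸ M i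
      rowLengths i i<m = trans (cong length (rowAt-filling q b i<m)) (length-shiftedRow (b i) (proj₁ (fits i i<m)) (proj₂ (fits i i<m)))
      rowsSorted : ∀ i j a c → entry mu (filling q b) i j ≡ just a → entry mu (filling q b) i (suc j) ≡ just c → a ≤S c
      rowsSorted i j a c eq₁ eq₂ with boxEntry-just {M i} {L i} {q i} {q i + bit (b i)} (trans (sym (entry-filling fits i j)) eq₁)
                                    | boxEntry-just {M i} {L i} {q i} {q i + bit (b i)} (trans (sym (entry-filling fits i (suc j))) eq₂)
      ... | _ , _ , refl | _ , _ , refl = cell-rowSorted (q i) (b i) j
      columnsSorted : ∀ i j a c → entry mu (filling q b) i j ≡ just a → entry mu (filling q b) (suc i) j ≡ just c → a ≤S c
      columnsSorted i j a c eq₁ eq₂ with boxEntry-just {M i} {L i} {q i} {q i + bit (b i)} (trans (sym (entry-filling fits i j)) eq₁)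
                                       | boxEntry-just {M (suc i)} {L (suc i)} {q (suc i)} {q (suc i) + bit (b (suc i))} (trans (sym (entry-filling fits (suc i) j)) eq₂)
      ... | _ , _ , refl | _ , j<L , refl with suc i <? m
      ...   | yes 1+i<m = cell-columnSorted (q i) (q i + bit (b i)) (q (suc i)) (q (suc i) + bit (b (suc i))) j (m≤m+n _ _) (strict i 1+i<m)
      ...   | no 1+i≮m  = contradiction (≤-trans j<L (≤-reflexive (L-beyond (≮⇒≥ 1+i≮m)))) λ ()

module Parse (la mu : List ℕ) (λ↓ : ∀ i → part la (suc i) ≤ part la i) (μ↓ : ∀ i → part mu (suc i) ≤ part mu i)
             (μ≤λ : Contained mu la) (T : Filling) (valid : IsSVRPP12 la mu T) where
  open Canonical la mu

  private
    lengthT = proj₁ valid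
    rowLength = proj₁ (proj₂ valid)
    rowSorted = proj₁ (proj₂ (proj₂ valid))
    columnSorted = proj₂ (proj₂ (proj₂ valid))
    r : ℕ → List S12
    r = rowAt T
    q = firstTwo mu T
    b = hasPair T
    p : ℕ → ℕ
    p i = q i + bit (b i)

  entry-rowAt : ∀ i t → i < m → entry mu T i (M i + t) ≡ nth (r i) t
  entry-rowAt i t i<m = trans (entry-nth mu {T} {i} (M i + t) (nth-rowAt T (subst (i <_) (sym lengthT) i<m)))
    (trans (cong (λ c → if c then nothing else nth (r i) (M i + t ∸ M i)) (<ᵇ-false (m≤m+n (M i) t)))
           (cong (nth (r i)) (m+n∸m≡n (M i) t)))

  rowAt-sorted : ∀ i → i < m → SortedRow (r i)
  rowAt-sorted i i<m t a b eq₁ eq₂ = rowSorted i (M i + t) a b (trans (entry-rowAt i t i<m) eq₁)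
    (trans (cong (entry mu T i) (sym (+-suc (M i) t))) (trans (entry-rowAt i (suc t) i<m) eq₂))

  rowAt-form : ∀ i → i < m → row (ones (r i)) (hasPair T i) (twos (r i)) ≡ r i
  rowAt-form i i<m = row-of-sorted (r i) (rowAt-sorted i i<m)

  row-lengths : ∀ i → i < m → ones (r i) + bit (hasPair T i) + twos (r i) ≡ L i ∸ M i
  row-lengths i i<m = trans (sym (length-row (ones (r i)) (hasPair T i) (twos (r i)))) (trans (cong length (rowAt-form i i<m)) (rowLength i i<m))

  twos≡ : ∀ i → i < m → L i ∸ (firstTwo mu T i + bit (hasPair T i)) ≡ twos (r i)
  twos≡ i i<m = begin
    L i ∸ (M i + ones (r i) + bit (hasPair T i))     ≡⟨ cong (L i ∸_) (+-assoc (M i) _ _) ⟩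
    L i ∸ (M i + (ones (r i) + bit (hasPair T i)))   ≡⟨ sym (∸-+-assoc (L i) (M i) _) ⟩
    L i ∸ M i ∸ (ones (r i) + bit (hasPair T i))     ≡⟨ cong (_∸ (ones (r i) + bit (hasPair T i))) (sym (row-lengths i i<m)) ⟩
    ones (r i) + bit (hasPair T i) + twos (r i) ∸ (ones (r i) + bit (hasPair T i)) ≡⟨ m+n∸m≡n (ones (r i) + bit (hasPair T i)) (twos (r i)) ⟩
    twos (r i)                                       ∎
    where open ≡-Reasoning

  fits : Fits (firstTwo mu T) (hasPair T)
  fits i i<m = m≤m+n (M i) _ , (begin
    M i + ones (r i) + bit (hasPair T i)   ≡⟨ +-assoc (M i) _ _ ⟩
    M i + (ones (r i) + bit (hasPair T i)) ≤⟨ +-monoʳ-≤ (M i) (≤-trans (m≤m+n _ (twos (r i))) (≤-reflexive (row-lengths i i<m))) ⟩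
    M i + (L i ∸ M i)                      ≡⟨ m+[n∸m]≡n (μ≤λ i) ⟩
    L i                                    ∎)
    where open ≤-Reasoning

  T≡filling : T ≡ filling (firstTwo mu T) (hasPair T)
  T≡filling = trans (applyUpTo-rowAt T) (trans (cong (applyUpTo r) lengthT)
    (applyUpTo-cong m (λ i i<m → trans (sym (rowAt-form i i<m))
      (cong₂ (λ a c → row a (hasPair T i) c) (sym (m+n∸m≡n (M i) _)) (sym (twos≡ i i<m))))))

  entry-T : ∀ i j → entry mu T i j ≡ boxEntry (M i) (L i) (q i) (p i) j
  entry-T i j = trans (cong (λ X → entry mu X i j) T≡filling) (entry-filling fits i j)

  -- Otherwise column q i would hold a 2 in row i above a 1 in row i + 1.
  columnStrict : ColumnStrict q b
  columnStrict i 1+i<m with p (suc i) ≤? q i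
  ... | yes p≤q = p≤q
  ... | no p≰q  = contradiction (columnSorted i (q i) _ _ above below) 2≰1
    where
      q<p = ≰⇒> p≰q
      p≤L = proj₂ (fits (suc i) 1+i<m)
      M≤q = proj₁ (fits i (<-trans (n<1+n i) 1+i<m))
      above : entry mu T i (q i) ≡ just (cell (q i) (p i) (q i))
      above = trans (entry-T i (q i)) (boxEntry-inside {M i} {L i} {q i} {p i} M≤q (<-≤-trans q<p (≤-trans p≤L (λ↓ i))))
      below : entry mu T (suc i) (q i) ≡ just (cell (q (suc i)) (p (suc i)) (q i))
      below = trans (entry-T (suc i) (q i)) (boxEntry-inside {M (suc i)} {L (suc i)} {q (suc i)} {p (suc i)} (≤-trans (μ↓ i) M≤q) (<-≤-trans q<p p≤L))
      2≰1 : ¬ (cell (q i) (p i) (q i) ≤S cell (q (suc i)) (p (suc i)) (q i))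
      2≰1 le = contradiction (subst₂ _≤_ (maxS-cell≡2 (q i) (p i) ≤-refl) (minS-cell≡1 (q (suc i)) (p (suc i)) q<p) le) λ { (s≤s ()) }

-- Statistics of canonical fillings

data Position (M q p L j : ℕ) : Set where
  before  : j < M → Position M q p L j
  in-1    : M ≤ j → j < q → Position M q p L j
  in-12   : q ≤ j → j < p → Position M q p L j
  in-2    : p ≤ j → j < L → Position M q p L j
  after   : L ≤ j → Position M q p L j

position : ∀ M q p L j → Position M q p L j
position M q p L j with j <? M | j <? q | j <? p | j <? L
... | yes j<M | _       | _       | _       = before j<M
... | no j≮M  | yes j<q | _       | _       = in-1 (≮⇒≥ j≮M) j<q
... | no j≮M  | no j≮q  | yes j<p | _       = in-12 (≮⇒≥ j≮q) j<p
... | no j≮M  | no j≮q  | no j≮p  | yes j<L = in-2 (≮⇒≥ j≮p) j<L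
... | no j≮M  | no j≮q  | no j≮p  | no j≮L  = after (≮⇒≥ j≮L)

module _ {M q p L j : ℕ} (M≤q : M ≤ q) (q≤p : q ≤ p) (p≤L : p ≤ L) where

  boxEntry-has1 : entryHas (boxEntry M L q p j) 1 ≡ inRange M p j
  boxEntry-has1 with position M q p L j
  ... | before j<M rewrite boxEntry-below {M} {L} {q} {p} j<M = sym (inRange-below {M} {p} j<M)
  ... | in-1 M≤j j<q rewrite boxEntry-inside {M} {L} {q} {p} M≤j (≤-trans j<q (≤-trans q≤p p≤L)) | cell-1 {q} {p} j<q =
    sym (inRange-inside {M} {p} M≤j (≤-trans j<q q≤p))
  ... | in-12 q≤j j<p rewrite boxEntry-inside {M} {L} {q} {p} (≤-trans M≤q q≤j) (≤-trans j<p p≤L) | cell-12 {q} {p} q≤j j<p =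
    sym (inRange-inside {M} {p} (≤-trans M≤q q≤j) j<p)
  ... | in-2 p≤j j<L rewrite boxEntry-inside {M} {L} {q} {p} (≤-trans (≤-trans M≤q q≤p) p≤j) j<L | cell-2 {q} {p} (≤-trans q≤p p≤j) p≤j =
    sym (inRange-above {M} {p} p≤j)
  ... | after L≤j rewrite boxEntry-above {M} {L} {q} {p} L≤j = sym (inRange-above {M} {p} (≤-trans p≤L L≤j))

  boxEntry-has2 : entryHas (boxEntry M L q p j) 2 ≡ inRange q L j
  boxEntry-has2 with position M q p L j
  ... | before j<M rewrite boxEntry-below {M} {L} {q} {p} j<M = sym (inRange-below {q} {L} (≤-trans j<M M≤q))
  ... | in-1 M≤j j<q rewrite boxEntry-inside {M} {L} {q} {p} M≤j (≤-trans j<q (≤-trans q≤p p≤L)) | cell-1 {q} {p} j<q =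
    sym (inRange-below {q} {L} j<q)
  ... | in-12 q≤j j<p rewrite boxEntry-inside {M} {L} {q} {p} (≤-trans M≤q q≤j) (≤-trans j<p p≤L) | cell-12 {q} {p} q≤j j<p =
    sym (inRange-inside {q} {L} q≤j (≤-trans j<p p≤L))
  ... | in-2 p≤j j<L rewrite boxEntry-inside {M} {L} {q} {p} (≤-trans (≤-trans M≤q q≤p) p≤j) j<L | cell-2 {q} {p} (≤-trans q≤p p≤j) p≤j =
    sym (inRange-inside {q} {L} (≤-trans q≤p p≤j) j<L)
  ... | after L≤j rewrite boxEntry-above {M} {L} {q} {p} L≤j = sym (inRange-above {q} {L} L≤j)

entryHas-other : ∀ e k → k ≢ 1 → k ≢ 2 → entryHas e k ≡ false
entryHas-other nothing    k                 _  _  = refl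
entryHas-other (just s1)  zero              _  _  = refl
entryHas-other (just s2)  zero              _  _  = refl
entryHas-other (just s12) zero              _  _  = refl
entryHas-other (just a)   1                 ≢1 _  = contradiction refl ≢1
entryHas-other (just a)   2                 _  ≢2 = contradiction refl ≢2
entryHas-other (just s1)  (suc (suc (suc k))) _ _ = refl
entryHas-other (just s2)  (suc (suc (suc k))) _ _ = refl
entryHas-other (just s12) (suc (suc (suc k))) _ _ = refl

ceqTest-boxEntry : ∀ {M q p L M′ q′ p′ L′ j} → M ≤ q → q ≤ p → p ≤ L → M′ ≤ M → q′ ≤ p′ → p′ ≤ L′ → L′ ≤ L → p′ ≤ q →
  ceqTest (boxEntry M L q p j) (boxEntry M′ L′ q′ p′ j) ≡ (inRange M L′ j ∧ not (inRange p′ q j))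
ceqTest-boxEntry {M} {q} {p} {L} {M′} {q′} {p′} {L′} {j} M≤q q≤p p≤L M′≤M q′≤p′ p′≤L′ L′≤L p′≤q with j <? M | j <? L′
... | yes j<M | _ rewrite boxEntry-below {M} {L} {q} {p} j<M | inRange-below {M} {L′} j<M = refl
... | no j≮M | no j≮L′ rewrite boxEntry-above {M′} {L′} {q′} {p′} (≮⇒≥ j≮L′) | inRange-above {M} {L′} (≮⇒≥ j≮L′) with boxEntry M L q p j
...   | nothing = refl
...   | just _  = refl
ceqTest-boxEntry {M} {q} {p} {L} {M′} {q′} {p′} {L′} {j} M≤q q≤p p≤L M′≤M q′≤p′ p′≤L′ L′≤L p′≤q | no j≮M | yes j<L′
  rewrite inRange-inside {M} {L′} (≮⇒≥ j≮M) j<L′ | boxEntry-inside {M} {L} {q} {p} (≮⇒≥ j≮M) (≤-trans j<L′ L′≤L)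
        | boxEntry-inside {M′} {L′} {q′} {p′} (≤-trans M′≤M (≮⇒≥ j≮M)) j<L′ with j <? p′ | j <? q
... | yes j<p′ | _ rewrite maxS-cell≡1 q p (≤-trans j<p′ p′≤q) | minS-cell≡1 q′ p′ j<p′ | inRange-below {p′} {q} j<p′ = refl
... | no j≮p′ | yes j<q rewrite maxS-cell≡1 q p j<q | minS-cell≡2 q′ p′ q′≤p′ (≮⇒≥ j≮p′) | inRange-inside {p′} {q} (≮⇒≥ j≮p′) j<q = refl
... | no j≮p′ | no j≮q rewrite maxS-cell≡2 q p (≮⇒≥ j≮q) | minS-cell≡2 q′ p′ q′≤p′ (≮⇒≥ j≮p′) | inRange-above {p′} {q} (≮⇒≥ j≮q) = refl

module Statistics (la mu : List ℕ) (λ↓ : ∀ i → part la (suc i) ≤ part la i) (μ↓ : ∀ i → part mu (suc i) ≤ part mu i)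
                  (μ≤λ : Contained mu la) where
  open Canonical la mu

  L≤W : ∀ i → L i ≤ W
  L≤W zero    = ≤-refl
  L≤W (suc i) = ≤-trans (λ↓ i) (L≤W i)

  columns : ℕ
  columns = sumTo m (λ i → topsEnd i ∸ M i)

  M≤prev : ∀ i → M i ≤ prev W M i
  M≤prev zero    = μ≤λ 0
  M≤prev (suc i) = μ↓ i

  ex-filling : ∀ q q′ b i → ex (filling q b) i ≡ ex (filling q′ b) i
  ex-filling q q′ b i with i <? m
  ... | yes i<m = trans (cong excess (rowAt-filling q b i<m))
                    (trans (excess-row (q i ∸ M i) (b i) _) (sym (trans (cong excess (rowAt-filling q′ b i<m)) (excess-row (q′ i ∸ M i) (b i) _))))
  ... | no i≮m = trans (cong excess (rowAt-beyond {filling q b} {i} (nth-applyUpTo-beyond _ (≮⇒≥ i≮m))))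
                   (sym (cong excess (rowAt-beyond {filling q′ b} {i} (nth-applyUpTo-beyond _ (≮⇒≥ i≮m)))))

  module _ {q : ℕ → ℕ} {b : ℕ → Bool} (fits : Fits q b) (strict : ColumnStrict q b) where
    private
      p : ℕ → ℕ
      p i = q i + bit (b i)
      C = filling q b
      M≤q : ∀ {i} → i < m → M i ≤ q i
      M≤q i<m = proj₁ (fits _ i<m)
      p≤L : ∀ {i} → i < m → p i ≤ L i
      p≤L i<m = proj₂ (fits _ i<m)
      q≤p : ∀ i → q i ≤ p i
      q≤p i = m≤m+n (q i) (bit (b i))
      q≤L : ∀ {i} → i < m → q i ≤ L i
      q≤L {i} i<m = ≤-trans (q≤p i) (p≤L i<m)
      entry-C : ∀ i j → entry mu C i j ≡ boxEntry (M i) (L i) (q i) (p i) j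
      entry-C = entry-filling fits

    ircont-1 : ircont la mu C 1 ≡ sumTo m (λ i → (p i ⊓ prev W M i) ∸ M i)
    ircont-1 = trans
      (count-cong W (λ j _ → anyBelow-cong m (λ i i<m → trans (cong (λ e → entryHas e 1) (entry-C i j)) (boxEntry-has1 (M≤q i<m) (q≤p i) (p≤L i<m)))))
      (Staircase.count-covered M p W m (λ i _ → μ↓ i)
        (λ i 1+i<m → ≤-trans (strict i 1+i<m) (q≤p i))
        (λ i i<m → ≤-trans (p≤L i<m) (L≤W i)))

    ircont-2 : ircont la mu C 2 ≡ sumTo m (λ i → (L i ⊓ prev W q i) ∸ q i)
    ircont-2 = trans
      (count-cong W (λ j _ → anyBelow-cong m (λ i i<m → trans (cong (λ e → entryHas e 2) (entry-C i j)) (boxEntry-has2 (M≤q i<m) (q≤p i) (p≤L i<m)))))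
      (Staircase.count-covered q L W m (λ i 1+i<m → ≤-trans (q≤p (suc i)) (strict i 1+i<m)) (λ i _ → λ↓ i) (λ i _ → L≤W i))

    ircont-other : ∀ k → k ≢ 1 → k ≢ 2 → ircont la mu C k ≡ 0
    ircont-other k ≢1 ≢2 =
      trans (count-cong W (λ j _ → anyBelow-false _ m (λ i _ → entryHas-other (entry mu C i j) k ≢1 ≢2))) (count-false W)

    ircont-1+topsWithout1≡columns : ircont la mu C 1 + sumTo m (λ i → topsEnd i ∸ p i) ≡ columns
    ircont-1+topsWithout1≡columns =
      trans (cong (_+ sumTo m (λ i → topsEnd i ∸ p i)) ircont-1)
        (trans (sumTo-distrib-+ m _ _)
          (sumTo-cong m (λ i i<m → [b⊓d∸a]+[d⊓c∸b]≡d⊓c∸a (≤-trans (M≤q i<m) (q≤p i)) (p≤L i<m) (M≤prev i))))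

    columns≡byBottom : columns ≡ sumTo m (λ i → L i ∸ (M i ⊔ L (suc i)))
    columns≡byBottom = begin
      sumTo m (λ i → topsEnd i ∸ M i)
        ≡⟨ sumTo-cong m (λ i _ → cong (_∸ M i) (⊓-comm (prev W M i) (L i))) ⟩
      sumTo m (λ i → (L i ⊓ prev W M i) ∸ M i)
        ≡⟨ Staircase.sumTo-byTop≡sumTo-byBottom-0 M L W m (L-beyond ≤-refl) ≤-refl (λ i _ → μ≤λ i) (λ i _ → M≤prev i) (λ i _ → λ↓ i) ⟩
      sumTo m (λ i → L i ∸ (M i ⊔ L (suc i))) ∎
      where open ≡-Reasoning

    ircont-2+bottomsWithout2≡columns : ircont la mu C 2 + sumTo m (λ i → q i ∸ bottomsStart i) ≡ columns
    ircont-2+bottomsWithout2≡columns = begin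
      ircont la mu C 2 + sumTo m (λ i → q i ∸ bottomsStart i)
        ≡⟨ cong (_+ sumTo m (λ i → q i ∸ bottomsStart i)) (trans ircont-2 byBottom) ⟩
      sumTo m (λ i → L i ∸ (q i ⊔ L (suc i))) + sumTo m (λ i → q i ∸ bottomsStart i)
        ≡⟨ sumTo-distrib-+ m _ _ ⟩
      sumTo m (λ i → L i ∸ (q i ⊔ L (suc i)) + (q i ∸ bottomsStart i))
        ≡⟨ sumTo-cong m (λ i i<m → [c∸b⊔d]+[b∸d⊔a]≡c∸a⊔d (M≤q i<m) (q≤L i<m) (λ↓ i)) ⟩
      sumTo m (λ i → L i ∸ (M i ⊔ L (suc i)))
        ≡⟨ sym columns≡byBottom ⟩
      columns ∎
      where
        open ≡-Reasoning
        q≤prev : ∀ i → i < m → q i ≤ prev W q i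
        q≤prev zero    0<m   = ≤-trans (q≤L 0<m) (L≤W 0)
        q≤prev (suc i) 1+i<m = ≤-trans (q≤p (suc i)) (strict i 1+i<m)
        byBottom : sumTo m (λ i → (L i ⊓ prev W q i) ∸ q i) ≡ sumTo m (λ i → L i ∸ (q i ⊔ L (suc i)))
        byBottom = Staircase.sumTo-byTop≡sumTo-byBottom-0 q L W m (L-beyond ≤-refl) ≤-refl (λ i i<m → q≤L i<m) q≤prev (λ i _ → λ↓ i)

    ceq+strictPairs : ∀ i → ceq la mu C i + strictPairs q b i ≡ L (suc i) ∸ M i
    ceq+strictPairs i with suc i <? m
    ... | yes 1+i<m = begin
      ceq la mu C i + strictPairs q b i
        ≡⟨ cong₂ _+_ (count-cong W (λ j _ → trans (cong₂ ceqTest (entry-C i j) (entry-C (suc i) j))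
                                                   (ceqTest-boxEntry (M≤q i<m) (q≤p i) (p≤L i<m) (μ↓ i) (q≤p (suc i)) (p≤L 1+i<m) (λ↓ i) (strict i 1+i<m))))
                     (sym strictPairs≡count) ⟩
      count (λ j → inRange (M i) (L (suc i)) j ∧ not (inRange (p (suc i)) (q i) j)) W
        + count (λ j → inRange (M i) (L (suc i)) j ∧ inRange (p (suc i)) (q i) j) W
        ≡⟨ count-∧-not+count-∧ W (inRange (M i) (L (suc i))) (inRange (p (suc i)) (q i)) ⟩
      count (inRange (M i) (L (suc i))) W
        ≡⟨ count-inRange (M i) (L (suc i)) W ⟩
      (L (suc i) ⊓ W) ∸ M i
        ≡⟨ cong (_∸ M i) (m≤n⇒m⊓n≡m (L≤W (suc i))) ⟩
      L (suc i) ∸ M i ∎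
      where
        open ≡-Reasoning
        i<m = <-trans (n<1+n i) 1+i<m
        strictPairs≡count : count (λ j → inRange (M i) (L (suc i)) j ∧ inRange (p (suc i)) (q i) j) W ≡ strictPairs q b i
        strictPairs≡count = begin
          count (λ j → inRange (M i) (L (suc i)) j ∧ inRange (p (suc i)) (q i) j) W
            ≡⟨ count-cong W (λ j _ → inRange-∧ (M i) (L (suc i)) (p (suc i)) (q i) j) ⟩
          count (inRange (M i ⊔ p (suc i)) (L (suc i) ⊓ q i)) W
            ≡⟨ count-inRange (M i ⊔ p (suc i)) (L (suc i) ⊓ q i) W ⟩
          (L (suc i) ⊓ q i) ⊓ W ∸ (M i ⊔ p (suc i))
            ≡⟨ cong (_∸ (M i ⊔ p (suc i))) (trans (m≤n⇒m⊓n≡m (≤-trans (m⊓n≤m (L (suc i)) (q i)) (L≤W (suc i)))) (⊓-comm (L (suc i)) (q i))) ⟩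
          strictPairs q b i ∎
    ... | no 1+i≮m = begin
      ceq la mu C i + strictPairs q b i
        ≡⟨ cong₂ _+_ (trans (count-cong W (λ j _ → noBoxBelow j)) (count-false W))
                     (trans (cong (λ z → (q i ⊓ z) ∸ (M i ⊔ p (suc i))) L[1+i]≡0) (cong (_∸ (M i ⊔ p (suc i))) (⊓-zeroʳ (q i)))) ⟩
      0 + (0 ∸ (M i ⊔ p (suc i)))
        ≡⟨ 0∸n≡0 (M i ⊔ p (suc i)) ⟩
      0
        ≡⟨ sym (0∸n≡0 (M i)) ⟩
      0 ∸ M i
        ≡⟨ cong (_∸ M i) (sym L[1+i]≡0) ⟩
      L (suc i) ∸ M i ∎
      where
        open ≡-Reasoning
        L[1+i]≡0 = L-beyond (≮⇒≥ 1+i≮m)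
        noBoxBelow : ∀ j → ceqTest (entry mu C i j) (entry mu C (suc i) j) ≡ false
        noBoxBelow j rewrite entry-C (suc i) j | boxEntry-above {M (suc i)} {L (suc i)} {q (suc i)} {p (suc i)} {j} (≤-trans (≤-reflexive L[1+i]≡0) z≤n)
          with entry mu C i j
        ... | nothing = refl
        ... | just _  = refl

-- The involution

strictPairs-identity : ∀ {M₀ L₁ q₀ p₁} → M₀ ≤ q₀ → p₁ ≤ L₁ → p₁ ≤ q₀ →
  ((M₀ ⊓ L₁) ⊔ p₁) + (((q₀ ⊓ L₁) ∸ (M₀ ⊔ p₁)) + (M₀ ∸ L₁)) ≡ q₀ ⊓ (L₁ ⊔ M₀)
strictPairs-identity {M₀} {L₁} {q₀} {p₁} M≤q p≤L p≤q with ≤-total L₁ M₀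
... | inj₁ L≤M rewrite m≥n⇒m⊓n≡n L≤M | m≥n⇒m⊔n≡m p≤L | m≤n⇒m⊔n≡n L≤M | m≥n⇒m⊓n≡n M≤q
                     | m≤n⇒m∸n≡0 {q₀ ⊓ L₁} {M₀ ⊔ p₁} (≤-trans (m⊓n≤n q₀ L₁) (≤-trans L≤M (m≤m⊔n M₀ p₁))) = m+[n∸m]≡n L≤M
... | inj₂ M≤L rewrite m≤n⇒m⊓n≡m M≤L | m≥n⇒m⊔n≡m M≤L | m≤n⇒m∸n≡0 M≤L | +-identityʳ ((q₀ ⊓ L₁) ∸ (M₀ ⊔ p₁)) =
  m+[n∸m]≡n (⊔-lub (⊓-glb M≤q M≤L) (⊓-glb p≤q p≤L))

strictPairs-identity⁻¹ : ∀ {M₀ L₁ q₀ p₁ β} → M₀ ≤ q₀ → p₁ ≤ L₁ →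
  ((M₀ ⊓ L₁) ⊔ p₁) + (β + (M₀ ∸ L₁)) ≡ q₀ ⊓ (L₁ ⊔ M₀) → p₁ ≤ q₀ × β ≡ (q₀ ⊓ L₁) ∸ (M₀ ⊔ p₁)
strictPairs-identity⁻¹ {M₀} {L₁} {q₀} {p₁} {β} M≤q p≤L eq =
  p≤q , +-cancelʳ-≡ (M₀ ∸ L₁) β _ (+-cancelˡ-≡ ((M₀ ⊓ L₁) ⊔ p₁) _ _ (trans eq (sym (strictPairs-identity M≤q p≤L p≤q))))
  where
    p≤q : p₁ ≤ q₀
    p≤q = ≤-trans (m≤n⊔m (M₀ ⊓ L₁) p₁) (≤-trans (m≤m+n _ _) (≤-trans (≤-reflexive eq) (m⊓n≤m q₀ _)))

module Coordinates (la mu : List ℕ) (βs : List ℕ) (bs : List Bool) where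
  open Canonical la mu

  β e gap c : ℕ → ℕ
  β k = lookupOr 0 βs k
  e k = bit (lookupOr false bs k)
  gap k = M k ∸ L (suc k)
  c k = β k + gap k

  -- shift is chosen so that, after cancelling shift i, the glue equation of a RawPath for A and G
  -- at i is strictPairs-identity for the rows i and i + 1.
  shift : ℕ → ℕ
  shift zero    = 0
  shift (suc k) = shift k + e (suc k) + c k

  A G : ℕ → ℕ
  A k = (topsEnd k + shift k) ∸ e k
  G k = bottomsStart k + shift k

  A-suc : ∀ k → A (suc k) ≡ topsEnd (suc k) + shift k + c k
  A-suc k = trans (cong (_∸ e (suc k)) (solve 4 (λ a s e c → a :+ (s :+ e :+ c) := a :+ s :+ c :+ e) refl (topsEnd (suc k)) (shift k) (e (suc k)) (c k)))
                  (m+n∸n≡m (topsEnd (suc k) + shift k + c k) (e (suc k)))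

  A⊔shifted : ∀ (q : ℕ → ℕ) k →
    A (suc k) ⊔ (q (suc k) + shift (suc k)) ≡ (topsEnd (suc k) ⊔ (q (suc k) + e (suc k))) + c k + shift k
  A⊔shifted q k = begin
    A (suc k) ⊔ (q (suc k) + shift (suc k))
      ≡⟨ cong₂ _⊔_ (trans (A-suc k) (+-assoc (topsEnd (suc k)) (shift k) (c k)))
                   (solve 4 (λ x s e c → x :+ (s :+ e :+ c) := x :+ e :+ (s :+ c)) refl (q (suc k)) (shift k) (e (suc k)) (c k)) ⟩
    (topsEnd (suc k) + (shift k + c k)) ⊔ ((q (suc k) + e (suc k)) + (shift k + c k))
      ≡⟨ sym (+-distribʳ-⊔ (shift k + c k) (topsEnd (suc k)) (q (suc k) + e (suc k))) ⟩
    (topsEnd (suc k) ⊔ (q (suc k) + e (suc k))) + (shift k + c k)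
      ≡⟨ solve 3 (λ t s c → t :+ (s :+ c) := t :+ c :+ s) refl (topsEnd (suc k) ⊔ (q (suc k) + e (suc k))) (shift k) (c k) ⟩
    (topsEnd (suc k) ⊔ (q (suc k) + e (suc k))) + c k + shift k ∎
    where open ≡-Reasoning

  shifted⊓G : ∀ (q : ℕ → ℕ) k → (q k + shift k) ⊓ G k ≡ (q k ⊓ bottomsStart k) + shift k
  shifted⊓G q k = sym (+-distribʳ-⊓ (shift k) (q k) (bottomsStart k))

  deficit-shift : ∀ (q : ℕ → ℕ) k → A k ∸ (q k + shift k) ≡ topsEnd k ∸ (q k + e k)
  deficit-shift q k = [a+s]∸e∸[q+s]≡a∸[q+e] (topsEnd k) (shift k) (e k) (q k)

  excess-shift : ∀ (q : ℕ → ℕ) k → (q k + shift k) ∸ G k ≡ q k ∸ bottomsStart k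
  excess-shift q k = [m+o]∸[n+o]≡m∸n (q k) (shift k) (bottomsStart k)

module Involution (la mu : List ℕ) where
  open Canonical la mu

  -- Φ reads T through lists of length m, so that Φ (Φ T) depends only on values below m.
  starts : Filling → List ℕ
  starts T = applyUpTo (firstTwo mu T) m

  pairs : Filling → List Bool
  pairs T = applyUpTo (hasPair T) m

  strictPairsList : List ℕ → List Bool → List ℕ
  strictPairsList qs bs = applyUpTo (strictPairs (lookupOr 0 qs) (lookupOr false bs)) m

  flipStartsWith : List ℕ → List ℕ → List Bool → ℕ → ℕ
  flipStartsWith βs qs bs k = RawPathFlip.flip (pred m) A G (λ i → lookupOr 0 qs i + shift i) k ∸ shift k
    where open Coordinates la mu βs bs

  Φ : Filling → Filling
  Φ T = filling (flipStartsWith (strictPairsList (starts T) (pairs T)) (starts T) (pairs T)) (lookupOr false (pairs T))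

module Correctness (l : ℕ) (ls mu : List ℕ) (λ-partition : IsPartition (l ∷ ls)) (μ-partition : IsPartition mu)
                   (μ≤λ : Contained mu (l ∷ ls)) where
  private
    la = l ∷ ls
    m′ = length ls
  open Canonical la mu
  open Involution la mu

  λ↓ : ∀ i → L (suc i) ≤ L i
  λ↓ = part-antitone la (proj₁ λ-partition)

  μ↓ : ∀ i → M (suc i) ≤ M i
  μ↓ = part-antitone mu (proj₁ μ-partition)

  module Flipped (q : ℕ → ℕ) (bs : List Bool) (fits : Fits q (lookupOr false bs)) (strict : ColumnStrict q (lookupOr false bs)) where
    b : ℕ → Bool
    b = lookupOr false bs

    βs : List ℕ
    βs = applyUpTo (strictPairs q b) m

    open Coordinates la mu βs bs
    open RawPathFlip m′ A G

    β≡strictPairs : ∀ {k} → k < m → β k ≡ strictPairs q b k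
    β≡strictPairs = lookupOr-applyUpTo 0 (strictPairs q b)

    x : ℕ → ℕ
    x k = q k + shift k

    topsEnd-0 : topsEnd 0 ≡ L 0
    topsEnd-0 = ⊓-idem (L 0)

    raw : RawPath m′ A G x
    raw = record
      { start = start
      ; end   = +-monoˡ-≤ (shift m′) (subst (λ z → z ⊔ M m′ ≤ q m′) (sym (L-beyond ≤-refl)) (proj₁ (fits m′ ≤-refl)))
      ; glue  = λ k 1+k<m → trans (A⊔shifted q k) (trans (cong (_+ shift k) (glue-row k 1+k<m)) (sym (shifted⊓G q k)))
      }
      where
        start : q 0 + 0 ≤ (topsEnd 0 + 0) ∸ e 0
        start = begin
          q 0 + 0                ≡⟨ +-identityʳ (q 0) ⟩
          q 0                    ≤⟨ m+n≤o⇒m≤o∸n (q 0) (proj₂ (fits 0 (s≤s z≤n))) ⟩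
          L 0 ∸ e 0              ≡⟨ cong (_∸ e 0) (sym (trans (+-identityʳ (topsEnd 0)) topsEnd-0)) ⟩
          (topsEnd 0 + 0) ∸ e 0  ∎
          where open ≤-Reasoning
        glue-row : ∀ k → suc k < m → (topsEnd (suc k) ⊔ (q (suc k) + e (suc k))) + c k ≡ q k ⊓ bottomsStart k
        glue-row k 1+k<m = trans (cong (λ z → (topsEnd (suc k) ⊔ (q (suc k) + e (suc k))) + (z + gap k)) (β≡strictPairs (<-trans (n<1+n k) 1+k<m)))
                                 (strictPairs-identity (proj₁ (fits k (<-trans (n<1+n k) 1+k<m))) (proj₂ (fits (suc k) 1+k<m)) (strict k 1+k<m))

    x′ q′ : ℕ → ℕ
    x′ = flip x
    q′ k = x′ k ∸ shift k

    raw′ : RawPath m′ A G x′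
    raw′ = flip-raw x raw

    private
      module R′ = RawPath raw′
      open RawPathProperties raw′

    shift+M≤x′ : ∀ k → k < m → shift k + M k ≤ x′ k
    shift+M≤x′ k k<m with suc k <? m
    ... | yes 1+k<m = ≤-trans shift+M≤A (A≤x k 1+k<m)
      where
        M≤topsEnd+c : M k ≤ topsEnd (suc k) + c k
        M≤topsEnd+c = ≤-trans (≤-reflexive (m≡m⊓n+[m∸n] (M k) (L (suc k)))) (+-monoʳ-≤ (topsEnd (suc k)) (m≤n+m (gap k) (β k)))
        shift+M≤A : shift k + M k ≤ A (suc k)
        shift+M≤A = begin
          shift k + M k                         ≤⟨ +-monoʳ-≤ (shift k) M≤topsEnd+c ⟩
          shift k + (topsEnd (suc k) + c k)     ≡⟨ solve 3 (λ s t c → s :+ (t :+ c) := t :+ s :+ c) refl (shift k) (topsEnd (suc k)) (c k) ⟩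
          topsEnd (suc k) + shift k + c k       ≡⟨ sym (A-suc k) ⟩
          A (suc k)                             ∎
          where open ≤-Reasoning
    ... | no 1+k≮m with ≤-antisym (≤-pred k<m) (≤-pred (≮⇒≥ 1+k≮m))
    ...   | refl = ≤-trans (≤-reflexive (+-comm (shift m′) (M m′))) (≤-trans (+-monoˡ-≤ (shift m′) (m≤n⊔m (L m) (M m′))) R′.end)

    x′+e≤L+shift : ∀ k → k < m → x′ k + e k ≤ L k + shift k
    x′+e≤L+shift zero 0<m = begin
      x′ 0 + e 0                ≤⟨ +-monoˡ-≤ (e 0) R′.start ⟩
      (topsEnd 0 + 0) ∸ e 0 + e 0 ≡⟨ m∸n+n≡m e≤topsEnd ⟩
      topsEnd 0 + 0             ≡⟨ cong (_+ 0) topsEnd-0 ⟩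
      L 0 + 0                   ∎
      where
        open ≤-Reasoning
        e≤topsEnd : e 0 ≤ topsEnd 0 + 0
        e≤topsEnd = ≤-trans (m≤n+m (e 0) (q 0)) (≤-trans (proj₂ (fits 0 0<m)) (≤-reflexive (sym (trans (+-identityʳ _) topsEnd-0))))
    x′+e≤L+shift (suc k) 1+k<m = begin
      x′ (suc k) + e (suc k)                      ≤⟨ +-monoˡ-≤ (e (suc k)) (x≤G k 1+k<m) ⟩
      (L (suc k) ⊔ M k) + shift k + e (suc k)    ≡⟨ cong (λ z → z + shift k + e (suc k)) (trans (⊔-comm (L (suc k)) (M k)) (m⊔n≡n+[m∸n] (M k) (L (suc k)))) ⟩
      L (suc k) + gap k + shift k + e (suc k)    ≤⟨ +-monoˡ-≤ (e (suc k)) (+-monoˡ-≤ (shift k) (+-monoʳ-≤ (L (suc k)) (m≤n+m (gap k) (β k)))) ⟩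
      L (suc k) + c k + shift k + e (suc k)      ≡⟨ solve 4 (λ l c s e → l :+ c :+ s :+ e := l :+ (s :+ e :+ c)) refl (L (suc k)) (c k) (shift k) (e (suc k)) ⟩
      L (suc k) + shift (suc k)                  ∎
      where open ≤-Reasoning

    x′≡q′+shift : ∀ k → k < m → x′ k ≡ q′ k + shift k
    x′≡q′+shift k k<m = sym (m∸n+n≡m (≤-trans (m≤m+n (shift k) (M k)) (shift+M≤x′ k k<m)))

    fits′ : Fits q′ b
    fits′ k k<m = m+n≤o⇒m≤o∸n (M k) (≤-trans (≤-reflexive (+-comm (M k) (shift k))) (shift+M≤x′ k k<m))
                , +-cancelʳ-≤ (shift k) _ _ (begin
                    q′ k + e k + shift k ≡⟨ solve 3 (λ a b c → a :+ b :+ c := a :+ c :+ b) refl (q′ k) (e k) (shift k) ⟩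
                    q′ k + shift k + e k ≡⟨ cong (_+ e k) (sym (x′≡q′+shift k k<m)) ⟩
                    x′ k + e k           ≤⟨ x′+e≤L+shift k k<m ⟩
                    L k + shift k        ∎)
      where open ≤-Reasoning

    glue-row′ : ∀ k → suc k < m → (topsEnd (suc k) ⊔ (q′ (suc k) + e (suc k))) + c k ≡ q′ k ⊓ bottomsStart k
    glue-row′ k 1+k<m = +-cancelʳ-≡ (shift k) _ _ (begin
      (topsEnd (suc k) ⊔ (q′ (suc k) + e (suc k))) + c k + shift k ≡⟨ sym (A⊔shifted q′ k) ⟩
      A (suc k) ⊔ (q′ (suc k) + shift (suc k))                      ≡⟨ cong (A (suc k) ⊔_) (sym (x′≡q′+shift (suc k) 1+k<m)) ⟩
      A (suc k) ⊔ x′ (suc k)                                         ≡⟨ R′.glue k 1+k<m ⟩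
      x′ k ⊓ G k                                                     ≡⟨ cong (_⊓ G k) (x′≡q′+shift k (<-trans (n<1+n k) 1+k<m)) ⟩
      (q′ k + shift k) ⊓ G k                                         ≡⟨ shifted⊓G q′ k ⟩
      (q′ k ⊓ bottomsStart k) + shift k                              ∎)
      where open ≡-Reasoning

    strict′ : ColumnStrict q′ b
    strict′ k 1+k<m = proj₁ (strictPairs-identity⁻¹ (proj₁ (fits′ k (<-trans (n<1+n k) 1+k<m))) (proj₂ (fits′ (suc k) 1+k<m)) (glue-row′ k 1+k<m))

    strictPairs′ : ∀ k → strictPairs q′ b k ≡ strictPairs q b k
    strictPairs′ k with suc k <? m
    ... | yes 1+k<m = trans (sym (proj₂ (strictPairs-identity⁻¹ (proj₁ (fits′ k k<m)) (proj₂ (fits′ (suc k) 1+k<m)) (glue-row′ k 1+k<m))))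
                            (β≡strictPairs k<m)
      where k<m = <-trans (n<1+n k) 1+k<m
    ... | no 1+k≮m = trans (strictPairs-beyond q′ b (≮⇒≥ 1+k≮m)) (sym (strictPairs-beyond q b (≮⇒≥ 1+k≮m)))

    topsWithout1′ : sumTo m (λ k → topsEnd k ∸ (q′ k + e k)) ≡ sumTo m (λ k → q k ∸ bottomsStart k)
    topsWithout1′ = begin
      sumTo m (λ k → topsEnd k ∸ (q′ k + e k)) ≡⟨ sumTo-cong m (λ k k<m → trans (sym (deficit-shift q′ k)) (cong (A k ∸_) (sym (x′≡q′+shift k k<m)))) ⟩
      sumTo m (λ k → A k ∸ x′ k)               ≡⟨ sumTo-deficit-flip x raw ⟩
      sumTo m (λ k → x k ∸ G k)                ≡⟨ sumTo-cong m (λ k _ → excess-shift q k) ⟩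
      sumTo m (λ k → q k ∸ bottomsStart k)     ∎
      where open ≡-Reasoning

    bottomsWithout2′ : sumTo m (λ k → q′ k ∸ bottomsStart k) ≡ sumTo m (λ k → topsEnd k ∸ (q k + e k))
    bottomsWithout2′ = begin
      sumTo m (λ k → q′ k ∸ bottomsStart k)    ≡⟨ sumTo-cong m (λ k k<m → trans (sym (excess-shift q′ k)) (cong (_∸ G k) (sym (x′≡q′+shift k k<m)))) ⟩
      sumTo m (λ k → x′ k ∸ G k)               ≡⟨ sumTo-excess-flip x raw ⟩
      sumTo m (λ k → A k ∸ x k)                ≡⟨ sumTo-cong m (λ k _ → deficit-shift q k) ⟩
      sumTo m (λ k → topsEnd k ∸ (q k + e k))  ∎
      where open ≡-Reasoning

    flip-q′ : ∀ k → k < m → flip (λ i → lookupOr 0 (applyUpTo q′ m) i + shift i) k ∸ shift k ≡ q k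
    flip-q′ k k<m = begin
      flip (λ i → lookupOr 0 (applyUpTo q′ m) i + shift i) k ∸ shift k
        ≡⟨ cong (_∸ shift k) (flip-cong k k<m (λ i i<m → trans (cong (_+ shift i) (lookupOr-applyUpTo 0 q′ i<m)) (sym (x′≡q′+shift i i<m)))) ⟩
      flip x′ k ∸ shift k ≡⟨ cong (_∸ shift k) (flip-flip x raw k k<m) ⟩
      q k + shift k ∸ shift k ≡⟨ m+n∸n≡m (q k) (shift k) ⟩
      q k ∎
      where open ≡-Reasoning

  module _ (T : Filling) (valid : IsSVRPP12 la mu T) where
    private
      module P = Parse la mu λ↓ μ↓ μ≤λ T valid
      bs = pairs T
      q : ℕ → ℕ
      q = lookupOr 0 (starts T)
      b : ℕ → Bool
      b = lookupOr false bs
      q≡ : ∀ {i} → i < m → q i ≡ firstTwo mu T i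
      q≡ = lookupOr-applyUpTo 0 (firstTwo mu T)
      b≡ : ∀ {i} → i < m → b i ≡ hasPair T i
      b≡ = lookupOr-applyUpTo false (hasPair T)

      fits : Fits q b
      fits i i<m rewrite q≡ i<m | b≡ i<m = P.fits i i<m

      strict : ColumnStrict q b
      strict i 1+i<m rewrite q≡ 1+i<m | b≡ 1+i<m | q≡ (<-trans (n<1+n i) 1+i<m) = P.columnStrict i 1+i<m

      T≡ : T ≡ filling q b
      T≡ = trans P.T≡filling (applyUpTo-cong m (λ i i<m → cong₂ (shiftedRow (M i) (L i)) (sym (q≡ i<m)) (sym (b≡ i<m))))

      open Flipped q bs fits strict hiding (b)
      module ST = Statistics la mu λ↓ μ↓ μ≤λ

    Φ-valid : IsSVRPP12 la mu (Φ T)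
    Φ-valid = filling-valid fits′ strict′

    Φ-involutive : Φ (Φ T) ≡ T
    Φ-involutive = begin
      Φ (Φ T)
        ≡⟨ cong₂ (λ qs bs → filling (flipStartsWith (strictPairsList qs bs) qs bs) (lookupOr false bs)) starts′ pairs′ ⟩
      filling (flipStartsWith (strictPairsList (applyUpTo q′ m) bs) (applyUpTo q′ m) bs) b
        ≡⟨ cong (λ βs → filling (flipStartsWith βs (applyUpTo q′ m) bs) b) strictPairsList′ ⟩
      filling (flipStartsWith βs (applyUpTo q′ m) bs) b
        ≡⟨ filling-cong b flip-q′ ⟩
      filling q b
        ≡⟨ sym T≡ ⟩
      T ∎
      where
        open ≡-Reasoning
        starts′ : starts (Φ T) ≡ applyUpTo q′ m
        starts′ = applyUpTo-cong m (λ i i<m → firstTwo-filling fits′ i<m)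
        pairs′ : pairs (Φ T) ≡ bs
        pairs′ = applyUpTo-cong m (λ i i<m → trans (hasPair-filling q′ b i<m) (b≡ i<m))
        strictPairsList′ : strictPairsList (applyUpTo q′ m) bs ≡ βs
        strictPairsList′ = applyUpTo-cong m (λ k _ → trans (strictPairs-cong b (λ i i<m → lookupOr-applyUpTo 0 q′ i<m) k) (strictPairs′ k))

    Φ-ex : ∀ i → ex (Φ T) i ≡ ex T i
    Φ-ex i = trans (ST.ex-filling q′ q b i) (cong (λ X → ex X i) (sym T≡))

    Φ-ceq : ∀ i → ceq la mu (Φ T) i ≡ ceq la mu T i
    Φ-ceq i = trans (+-cancelʳ-≡ (strictPairs q b i) _ _ (begin
      ceq la mu (Φ T) i + strictPairs q b i   ≡⟨ cong (ceq la mu (Φ T) i +_) (sym (strictPairs′ i)) ⟩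
      ceq la mu (Φ T) i + strictPairs q′ b i  ≡⟨ ST.ceq+strictPairs fits′ strict′ i ⟩
      L (suc i) ∸ M i                         ≡⟨ sym (ST.ceq+strictPairs fits strict i) ⟩
      ceq la mu (filling q b) i + strictPairs q b i ∎)) (cong (λ X → ceq la mu X i) (sym T≡))
      where open ≡-Reasoning

    Φ-ircont-other : ∀ k → k ≢ 1 → k ≢ 2 → ircont la mu (Φ T) k ≡ ircont la mu T k
    Φ-ircont-other k ≢1 ≢2 = trans (ST.ircont-other fits′ strict′ k ≢1 ≢2)
                                   (sym (trans (cong (λ X → ircont la mu X k) T≡) (ST.ircont-other fits strict k ≢1 ≢2)))

    Φ-ircont : ∀ k → ircont la mu (Φ T) k ≡ ircont la mu T (swap12 k)
    Φ-ircont 1 = trans (+-cancelʳ-≡ _ _ _ (begin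
      ircont la mu (Φ T) 1 + sumTo m (λ k → q k ∸ bottomsStart k)
        ≡⟨ cong (ircont la mu (Φ T) 1 +_) (sym topsWithout1′) ⟩
      ircont la mu (Φ T) 1 + sumTo m (λ k → topsEnd k ∸ (q′ k + bit (b k)))
        ≡⟨ ST.ircont-1+topsWithout1≡columns fits′ strict′ ⟩
      ST.columns
        ≡⟨ sym (ST.ircont-2+bottomsWithout2≡columns fits strict) ⟩
      ircont la mu (filling q b) 2 + sumTo m (λ k → q k ∸ bottomsStart k) ∎)) (cong (λ X → ircont la mu X 2) (sym T≡))
      where open ≡-Reasoning
    Φ-ircont 2 = trans (+-cancelʳ-≡ _ _ _ (begin
      ircont la mu (Φ T) 2 + sumTo m (λ k → topsEnd k ∸ (q k + bit (b k)))
        ≡⟨ cong (ircont la mu (Φ T) 2 +_) (sym bottomsWithout2′) ⟩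
      ircont la mu (Φ T) 2 + sumTo m (λ k → q′ k ∸ bottomsStart k)
        ≡⟨ ST.ircont-2+bottomsWithout2≡columns fits′ strict′ ⟩
      ST.columns
        ≡⟨ sym (ST.ircont-1+topsWithout1≡columns fits strict) ⟩
      ircont la mu (filling q b) 1 + sumTo m (λ k → topsEnd k ∸ (q k + bit (b k))) ∎)) (cong (λ X → ircont la mu X 1) (sym T≡))
      where open ≡-Reasoning
    Φ-ircont k@0                   = Φ-ircont-other k (λ ()) (λ ())
    Φ-ircont k@(suc (suc (suc _))) = Φ-ircont-other k (λ ()) (λ ())

theorem2p2 : (la mu : List ℕ) → IsPartition la → IsPartition mu → Contained mu la →
    Σ (Filling → Filling) (λ Φ → ∀ T → IsSVRPP12 la mu T →
        IsSVRPP12 la mu (Φ T)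
        × Φ (Φ T) ≡ T
        × (∀ i → ceq la mu (Φ T) i ≡ ceq la mu T i)
        × (∀ i → ex (Φ T) i ≡ ex T i)
        × (∀ k → ircont la mu (Φ T) k ≡ ircont la mu T (swap12 k)))
theorem2p2 [] mu _ _ _ = Involution.Φ [] mu , λ
  { [] valid → valid , refl , (λ _ → refl) , (λ _ → refl) , (λ _ → refl)
  ; (_ ∷ _) (() , _) }
theorem2p2 (l ∷ ls) mu λ-partition μ-partition μ≤λ = Involution.Φ (l ∷ ls) mu , λ T valid →
  Φ-valid T valid , Φ-involutive T valid , Φ-ceq T valid , Φ-ex T valid , Φ-ircont T valid
  where open Correctness l ls mu λ-partition μ-partition μ≤λ
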